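{- Let $q$ be a prime power, $k\ge 1$ and $d\ge1$ integers, and write $d=\sigma q^{k-1}-\sum_{i=0}^{k-2}\varepsilon_i q^i$ with $\sigma$ an integer and $0\le\varepsilon_i\le q-1$. Let $C$ be a linear $[n,k,d]_q$ code with $n=g_q(k,d)$. Then for every $1\le r\le k$, \[d_r(C)=v_r\left(\sigma q^{k-r}-\sum_{i=r}^{k-1}\varepsilon_{i-1}q^{i-r}\right)-\sum_{i=1}^{r-1}\varepsilon_{i-1}v_i,\] and $C$ attains the Griesmer bound for the $r$th generalized Hamming weight, i.e. \[n=d_r(C)+\sum_{i=1}^{k-r}\left\lceil\frac{d_r(C)}{q^iv_r}\right\rceil .\]
   Context: $v_m=(q^m-1)/(q-1)$. $g_q(k,d)=\sum_{i=0}^{k-1}\lceil d/q^i\rceil$ is the Griesmer function. The representation of $d$ in the stated form (integer $\sigma$, digits $0\le \varepsilon_i\le q-1$) is unique. For a linear code $C$, the support of a subcode $C'$ is the set of coordinates in which some codeword of $C'$ is nonzero, and the $r$th generalized Hamming weight $d_r(C)$ is the minimum support size of an $r$-dimensional subcode of $C$; $d_1(C)$ is the minimum distance. -}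

module Defs where

open import Level using (Level; _⊔_)
open import Data.Nat using (ℕ; zero; suc)
import Data.Nat as N
open import Data.Nat.Primality using (Prime)
open import Data.Integer as ℤ using (ℤ)
open import Data.Fin using (Fin)
open import Data.Fin.Subset using (Subset; _∈_; ∣_∣)
open import Data.Product using (Σ; ∃; _×_; _,_)
open import Function.Bundles using (_⇔_)
open import Relation.Binary.PropositionalEquality using (_≡_)
open import Relation.Nullary using (¬_)
open import Algebra.Bundles using (CommutativeRing)

sumℕ : ℕ → (ℕ → ℕ) → ℕ
sumℕ zero    f = 0
sumℕ (suc m) f = sumℕ m f N.+ f m

-- Σ_{i = lo}^{hi} f i  (empty if hi < lo)
sumRange : ℕ → ℕ → (ℕ → ℕ) → ℕ
sumRange lo hi f = sumℕ (suc hi N.∸ lo) (λ j → f (lo N.+ j))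

-- ceiling division ⌈ a / b ⌉ (value at b = 0 irrelevant, set to 0)
⌈_/_⌉ : ℕ → ℕ → ℕ
⌈ a / zero ⌉  = 0
⌈ a / suc b ⌉ = (a N.+ b) N./ suc b

-- v_m = (q^m - 1)/(q - 1) = 1 + q + ... + q^{m-1}
v : ℕ → ℕ → ℕ
v q m = sumℕ m (λ i → q N.^ i)

griesmer : ℕ → ℕ → ℕ → ℕ
griesmer q k d = sumℕ k (λ i → ⌈ d / q N.^ i ⌉)

IsPrimePower : ℕ → Set
IsPrimePower q = ∃ λ p → ∃ λ m → Prime p × 1 N.≤ m × q ≡ p N.^ m

record Field (c ℓ : Level) : Set (Level.suc (c ⊔ ℓ)) where
  field
    commutativeRing : CommutativeRing c ℓ
  open CommutativeRing commutativeRing public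
  field
    0≉1     : ¬ (0# ≈ 1#)
    inverse : ∀ x → ¬ (x ≈ 0#) → ∃ λ y → x * y ≈ 1#

HasOrder : ∀ {c ℓ} → Field c ℓ → ℕ → Set (c ⊔ ℓ)
HasOrder F q = Σ (Fin q → Carrier) λ e →
  (∀ x → ∃ λ i → e i ≈ x) × (∀ i j → e i ≈ e j → i ≡ j)
  where open Field F

module LinAlg {c ℓ} (F : Field c ℓ) where
  open Field F

  sumF : ∀ {m} → (Fin m → Carrier) → Carrier
  sumF {zero}  f = 0#
  sumF {suc m} f = f Fin.zero + sumF (λ i → f (Fin.suc i))
    where import Data.Fin as Fin

  lincomb : ∀ {m n} → (Fin m → Carrier) → (Fin m → Fin n → Carrier) → Fin n → Carrier
  lincomb a vs j = sumF (λ i → a i * vs i j)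

  LinIndep : ∀ {m n} → (Fin m → Fin n → Carrier) → Set (c ⊔ ℓ)
  LinIndep vs = ∀ a → (∀ j → lincomb a vs j ≈ 0#) → ∀ i → a i ≈ 0#

  -- A linear [n,k]_q code C is given by a generator matrix G (k linearly
  -- independent rows in F^n); C = { u G : u ∈ F^k }.
  -- An r-dimensional subcode of C is given by r linearly independent
  -- message vectors U (rows U_i ∈ F^k); its elements are the codewords
  -- (a U) G, a ∈ F^r.
  subcodeWord : ∀ {r k n} → (Fin k → Fin n → Carrier) → (Fin r → Fin k → Carrier)
              → (Fin r → Carrier) → Fin n → Carrier
  subcodeWord G U a = lincomb (lincomb a U) G

  IsSupport : ∀ {r k n} → (Fin k → Fin n → Carrier) → (Fin r → Fin k → Carrier)
            → Subset n → Set (c ⊔ ℓ)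
  IsSupport G U S = ∀ j → (j ∈ S) ⇔ (∃ λ a → ¬ (subcodeWord G U a j ≈ 0#))

  IsGHW : ∀ {k n} → (Fin k → Fin n → Carrier) → (r w : ℕ) → Set (c ⊔ ℓ)
  IsGHW {k} {n} G r w =
    (∃ λ (U : Fin r → Fin k → Carrier) → ∃ λ (S : Subset n) →
        LinIndep U × IsSupport G U S × ∣ S ∣ ≡ w)
    × (∀ (U : Fin r → Fin k → Carrier) (S : Subset n) →
        LinIndep U → IsSupport G U S → w N.≤ ∣ S ∣)

{-# OPTIONS --safe #-}
-- The core is the residual-code bound: if c₀ is a codeword of minimum weight d₀, averaging over the
-- q words c + t c₀ (t ∈ F) shows that every codeword c whose message vanishes at a coordinate where
-- the message of c₀ does not has at least ⌈d₀/q⌉ nonzero entries off the support of c₀.  Iterating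
-- gives the Griesmer bound |supp D| ≥ g_q(r, d) for every r-dimensional subcode D.  When
-- n = g_q(k, d), the minimum weight is exactly d and the residual code meets the Griesmer bound
-- again, so adjoining c₀ to a small subcode of the residual code yields, by induction, an
-- r-dimensional subcode with support g_q(r, d).  Thus d_r = g_q(r, d), and the rest is arithmetic:
-- ⌈d/q^(i-1)⌉ = σ q^(k-i) − Σ_{j=i}^{k-1} ε_{j-1} q^(j-i) because the ε_j are base-q digits, and
-- ⌈g_q(r, d)/(q^j v_r)⌉ = ⌈d/q^(r+j-1)⌉ because d v_r ≤ q^(r-1) g_q(r, d) and g_q(r, d) ≤ v_r o
-- whenever d ≤ q^(r-1) o.
module Submission where

open import Defs
open import Data.Nat using (ℕ)
open import Data.Fin using (Fin)

module Arithmetic where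
  open import Data.Nat using (ℕ; zero; suc; _+_; _*_; _∸_; _^_; _≤_; _<_; z≤n; s≤s⁻¹; NonZero)
  open import Data.Integer as ℤ using (ℤ; +_)
  open import Data.Nat.Properties
  open import Data.Nat.DivMod using (_/_; _%_; m≡m%n+[m/n]*n; m%n<n; m<n*o⇒m/o<n; n/1≡n)
  import Data.Nat.Solver as ℕ-Solver
  import Data.Integer.Properties as ℤₚ
  import Data.Integer.Solver as ℤ-Solver
  open import Relation.Binary.PropositionalEquality using (_≡_; refl; sym; trans; cong; cong₂; module ≡-Reasoning)
  open import Relation.Nullary using (yes; no; contradiction)

  m≤n*⌈m/n⌉ : ∀ m n .{{_ : NonZero n}} → m ≤ n * ⌈ m / n ⌉
  m≤n*⌈m/n⌉ m n@(suc n-1) = +-cancelʳ-≤ n-1 m (n * ((m + n-1) / n)) (begin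
    m + n-1                             ≡⟨ m≡m%n+[m/n]*n (m + n-1) n ⟩
    (m + n-1) % n + (m + n-1) / n * n   ≤⟨ +-monoˡ-≤ _ (s≤s⁻¹ (m%n<n (m + n-1) n)) ⟩
    n-1 + (m + n-1) / n * n             ≡⟨ +-comm n-1 _ ⟩
    (m + n-1) / n * n + n-1             ≡⟨ cong (_+ n-1) (*-comm _ n) ⟩
    n * ((m + n-1) / n) + n-1           ∎)
    where open ≤-Reasoning

  -- Also true for n = 0, where ⌈ m / 0 ⌉ = 0.
  m≤n*o⇒⌈m/n⌉≤o : ∀ m n o → m ≤ n * o → ⌈ m / n ⌉ ≤ o
  m≤n*o⇒⌈m/n⌉≤o m zero        o _     = z≤n
  m≤n*o⇒⌈m/n⌉≤o m n@(suc n-1) o m≤n*o = s≤s⁻¹ (m<n*o⇒m/o<n (begin-strict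
    m + n-1      ≤⟨ +-monoˡ-≤ n-1 m≤n*o ⟩
    n * o + n-1  <⟨ +-monoʳ-< (n * o) (n<1+n n-1) ⟩
    n * o + n    ≡⟨ trans (+-comm (n * o) n) (cong (_+_ n) (*-comm n o)) ⟩
    suc o * n    ∎))
    where open ≤-Reasoning

  ⌈m/n⌉-monoˡ-≤ : ∀ {m m′} n → m ≤ m′ → ⌈ m / n ⌉ ≤ ⌈ m′ / n ⌉
  ⌈m/n⌉-monoˡ-≤                 zero      _    = z≤n
  ⌈m/n⌉-monoˡ-≤ {m′ = m′} n@(suc _) m≤m′ = m≤n*o⇒⌈m/n⌉≤o _ n _ (≤-trans m≤m′ (m≤n*⌈m/n⌉ m′ n))

  ⌈m/1⌉≡m : ∀ m → ⌈ m / 1 ⌉ ≡ m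
  ⌈m/1⌉≡m m = trans (n/1≡n (m + 0)) (+-identityʳ m)

  ⌈⌈m/n⌉/o⌉≡⌈m/n*o⌉ : ∀ m n o .{{_ : NonZero n}} .{{_ : NonZero o}} →
                      ⌈ ⌈ m / n ⌉ / o ⌉ ≡ ⌈ m / n * o ⌉
  ⌈⌈m/n⌉/o⌉≡⌈m/n*o⌉ m n o = ≤-antisym
    (m≤n*o⇒⌈m/n⌉≤o _ o _ (m≤n*o⇒⌈m/n⌉≤o m n _ (begin
       m                        ≤⟨ m≤n*⌈m/n⌉ m (n * o) {{m*n≢0 n o}} ⟩
       n * o * ⌈ m / n * o ⌉    ≡⟨ *-assoc n o _ ⟩
       n * (o * ⌈ m / n * o ⌉)  ∎)))
    (m≤n*o⇒⌈m/n⌉≤o m (n * o) _ (begin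
       m                                ≤⟨ m≤n*⌈m/n⌉ m n ⟩
       n * ⌈ m / n ⌉                    ≤⟨ *-monoʳ-≤ n (m≤n*⌈m/n⌉ ⌈ m / n ⌉ o) ⟩
       n * (o * ⌈ ⌈ m / n ⌉ / o ⌉)      ≡⟨ *-assoc n o _ ⟨
       n * o * ⌈ ⌈ m / n ⌉ / o ⌉        ∎))
    where open ≤-Reasoning

  m+e≡n*y⇒y≡⌈m/n⌉ : ∀ {m n e y} .{{_ : NonZero n}} → e ≤ n ∸ 1 → m + e ≡ n * y → y ≡ ⌈ m / n ⌉
  m+e≡n*y⇒y≡⌈m/n⌉ {m} {n@(suc n-1)} {e} {y} e≤n-1 m+e≡ny = ≤-antisym y≤⌈m/n⌉ ⌈m/n⌉≤y
    where
    ⌈m/n⌉≤y : ⌈ m / n ⌉ ≤ y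
    ⌈m/n⌉≤y = m≤n*o⇒⌈m/n⌉≤o m n y (≤-trans (m≤m+n m e) (≤-reflexive m+e≡ny))
    y≤⌈m/n⌉ : y ≤ ⌈ m / n ⌉
    y≤⌈m/n⌉ = s≤s⁻¹ (*-cancelˡ-< n y (suc ⌈ m / n ⌉) (begin-strict
      n * y                  ≡⟨ m+e≡ny ⟨
      m + e                  ≤⟨ +-mono-≤ (m≤n*⌈m/n⌉ m n) e≤n-1 ⟩
      n * ⌈ m / n ⌉ + n-1    <⟨ +-monoʳ-< _ (n<1+n n-1) ⟩
      n * ⌈ m / n ⌉ + n      ≡⟨ trans (*-suc n _) (+-comm n _) ⟨
      n * suc ⌈ m / n ⌉      ∎))
      where open ≤-Reasoning

  ⌈m/n⌉-unique : ∀ m n e (x : ℤ) .{{_ : NonZero n}} → e ≤ n ∸ 1 →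
                 + m ≡ + n ℤ.* x ℤ.- + e → x ≡ + ⌈ m / n ⌉
  ⌈m/n⌉-unique m n@(suc _) e x e≤n-1 m≡nx-e = solution x m+e≡nx
    where
    open ℤ-Solver.+-*-Solver
    m+e≡nx : + (m + e) ≡ + n ℤ.* x
    m+e≡nx = begin
      + (m + e)                   ≡⟨ ℤₚ.pos-+ m e ⟩
      + m ℤ.+ + e                 ≡⟨ cong (ℤ._+ + e) m≡nx-e ⟩
      + n ℤ.* x ℤ.- + e ℤ.+ + e   ≡⟨ solve 2 (λ a b → a :- b :+ b := a) refl (+ n ℤ.* x) (+ e) ⟩
      + n ℤ.* x                   ∎
      where open ≡-Reasoning
    solution : ∀ x → + (m + e) ≡ + n ℤ.* x → x ≡ + ⌈ m / n ⌉
    solution (+ y)       eq = cong +_ (m+e≡n*y⇒y≡⌈m/n⌉ e≤n-1 (ℤₚ.+-injective (trans eq (sym (ℤₚ.pos-* n y)))))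
    solution ℤ.-[1+ _ ] ()

  sumℕ-cong : ∀ m {f g : ℕ → ℕ} → (∀ i → i < m → f i ≡ g i) → sumℕ m f ≡ sumℕ m g
  sumℕ-cong zero    _   = refl
  sumℕ-cong (suc m) f≡g = cong₂ _+_ (sumℕ-cong m (λ i i<m → f≡g i (m<n⇒m<1+n i<m))) (f≡g m (n<1+n m))

  sumℕ-mono-≤ : ∀ m {f g : ℕ → ℕ} → (∀ i → f i ≤ g i) → sumℕ m f ≤ sumℕ m g
  sumℕ-mono-≤ zero    _   = z≤n
  sumℕ-mono-≤ (suc m) f≤g = +-mono-≤ (sumℕ-mono-≤ m f≤g) (f≤g m)

  sumℕ-head : ∀ m (f : ℕ → ℕ) → sumℕ (suc m) f ≡ f 0 + sumℕ m (λ i → f (suc i))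
  sumℕ-head zero    f = +-comm 0 (f 0)
  sumℕ-head (suc m) f = trans (cong (_+ f (suc m)) (sumℕ-head m f)) (+-assoc (f 0) _ _)

  sumℕ-+ : ∀ a b (f : ℕ → ℕ) → sumℕ (a + b) f ≡ sumℕ a f + sumℕ b (λ j → f (a + j))
  sumℕ-+ a zero    f = trans (cong (λ m → sumℕ m f) (+-identityʳ a)) (sym (+-identityʳ _))
  sumℕ-+ a (suc b) f = begin
    sumℕ (a + suc b) f                                   ≡⟨ cong (λ m → sumℕ m f) (+-suc a b) ⟩
    sumℕ (a + b) f + f (a + b)                           ≡⟨ cong (_+ f (a + b)) (sumℕ-+ a b f) ⟩
    sumℕ a f + sumℕ b (λ j → f (a + j)) + f (a + b)      ≡⟨ +-assoc (sumℕ a f) _ _ ⟩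
    sumℕ a f + sumℕ (suc b) (λ j → f (a + j))            ∎
    where open ≡-Reasoning

  *-distribˡ-sumℕ : ∀ c m (f : ℕ → ℕ) → c * sumℕ m f ≡ sumℕ m (λ j → c * f j)
  *-distribˡ-sumℕ c zero    f = *-zeroʳ c
  *-distribˡ-sumℕ c (suc m) f = trans (*-distribˡ-+ c (sumℕ m f) (f m)) (cong (_+ c * f m) (*-distribˡ-sumℕ c m f))

  m∸n≡1+[m∸1+n] : ∀ {m n} → n < m → m ∸ n ≡ suc (m ∸ suc n)
  m∸n≡1+[m∸1+n] {suc m} {zero}  _   = refl
  m∸n≡1+[m∸1+n] {suc m} {suc n} n<m = m∸n≡1+[m∸1+n] (s≤s⁻¹ n<m)

  m≤e+o⇒⌈m/n⌉≤o : ∀ {m n e o} .{{_ : NonZero n}} → n * e ≤ (n ∸ 1) * m → m ≤ e + o → ⌈ m / n ⌉ ≤ o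
  m≤e+o⇒⌈m/n⌉≤o {m} {n@(suc n-1)} {e} {o} ne≤[n-1]m m≤e+o =
    m≤n*o⇒⌈m/n⌉≤o m n o (+-cancelˡ-≤ (n-1 * m) m (n * o) (begin
      n-1 * m + m        ≡⟨ +-comm (n-1 * m) m ⟩
      n * m              ≤⟨ *-monoʳ-≤ n m≤e+o ⟩
      n * (e + o)        ≡⟨ *-distribˡ-+ n e o ⟩
      n * e + n * o      ≤⟨ +-monoˡ-≤ (n * o) ne≤[n-1]m ⟩
      n-1 * m + n * o    ∎))
    where open ≤-Reasoning

  v-suc : ∀ q m → v q (suc m) ≡ 1 + q * v q m
  v-suc q zero    = cong suc (sym (*-zeroʳ q))
  v-suc q (suc m) = begin
    v q (suc m) + q * q ^ m          ≡⟨ cong (_+ q * q ^ m) (v-suc q m) ⟩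
    1 + q * v q m + q * q ^ m        ≡⟨ +-assoc 1 (q * v q m) _ ⟩
    1 + (q * v q m + q * q ^ m)      ≡⟨ cong suc (*-distribˡ-+ q (v q m) (q ^ m)) ⟨
    1 + q * v q (suc m)              ∎
    where open ≡-Reasoning

  v-nonZero : ∀ q m → NonZero (v q (suc m))
  v-nonZero q m rewrite v-suc q m = _

  module _ (q : ℕ) .{{q≢0 : NonZero q}} where

    griesmer-suc : ∀ m δ → griesmer q (suc m) δ ≡ δ + griesmer q m ⌈ δ / q ⌉
    griesmer-suc m δ = begin
      griesmer q (suc m) δ                           ≡⟨ sumℕ-head m (λ i → ⌈ δ / q ^ i ⌉) ⟩
      ⌈ δ / 1 ⌉ + sumℕ m (λ i → ⌈ δ / q * q ^ i ⌉)
        ≡⟨ cong₂ _+_ (⌈m/1⌉≡m δ)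
                     (sumℕ-cong m (λ i _ → sym (⌈⌈m/n⌉/o⌉≡⌈m/n*o⌉ δ q (q ^ i) {{q≢0}} {{m^n≢0 q i}}))) ⟩
      δ + griesmer q m ⌈ δ / q ⌉                     ∎
      where open ≡-Reasoning

    griesmer-monoʳ-≤ : ∀ m {x y} → x ≤ y → griesmer q m x ≤ griesmer q m y
    griesmer-monoʳ-≤ m x≤y = sumℕ-mono-≤ m (λ i → ⌈m/n⌉-monoˡ-≤ (q ^ i) x≤y)

    griesmer-cancel-≤ : ∀ m {x y} → griesmer q (suc m) x ≤ griesmer q (suc m) y → x ≤ y
    griesmer-cancel-≤ m {x} {y} gx≤gy with x ≤? y
    ... | yes x≤y = x≤y
    ... | no  x≰y = contradiction gx≤gy (<⇒≱ (begin-strict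
      griesmer q (suc m) y             ≡⟨ griesmer-suc m y ⟩
      y + griesmer q m ⌈ y / q ⌉       <⟨ +-monoˡ-< _ y<x ⟩
      x + griesmer q m ⌈ y / q ⌉       ≤⟨ +-monoʳ-≤ x (griesmer-monoʳ-≤ m (⌈m/n⌉-monoˡ-≤ q (<⇒≤ y<x))) ⟩
      x + griesmer q m ⌈ x / q ⌉       ≡⟨ griesmer-suc m x ⟨
      griesmer q (suc m) x             ∎))
      where
      open ≤-Reasoning
      y<x : y < x
      y<x = ≰⇒> x≰y

    module _ (d : ℕ) where
      open ℕ-Solver.+-*-Solver

      d≤q^r*o⇒griesmer≤v*o : ∀ r o → d ≤ q ^ r * o → griesmer q (suc r) d ≤ v q (suc r) * o
      d≤q^r*o⇒griesmer≤v*o zero    o d≤o      = ≤-trans (≤-reflexive (⌈m/1⌉≡m d)) d≤o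
      d≤q^r*o⇒griesmer≤v*o (suc r) o d≤qq^r*o = begin
        griesmer q (suc r) d + ⌈ d / q ^ suc r ⌉
          ≤⟨ +-mono-≤ (d≤q^r*o⇒griesmer≤v*o r (q * o) (≤-trans d≤qq^r*o (≤-reflexive
                        (solve 3 (λ a b x → b :* a :* x := a :* (b :* x)) refl (q ^ r) q o))))
                      (m≤n*o⇒⌈m/n⌉≤o d (q ^ suc r) o d≤qq^r*o) ⟩
        v q (suc r) * (q * o) + o
          ≡⟨ solve 3 (λ w b x → w :* (b :* x) :+ x := (con 1 :+ b :* w) :* x) refl (v q (suc r)) q o ⟩
        (1 + q * v q (suc r)) * o
          ≡⟨ cong (_* o) (v-suc q (suc r)) ⟨
        v q (suc (suc r)) * o
          ∎
        where open ≤-Reasoning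

      d*v≤q^r*griesmer : ∀ r → d * v q (suc r) ≤ q ^ r * griesmer q (suc r) d
      d*v≤q^r*griesmer zero    = ≤-reflexive (trans (*-identityʳ d) (sym (trans (+-identityʳ _) (⌈m/1⌉≡m d))))
      d*v≤q^r*griesmer (suc r) = begin
        d * v q (suc (suc r))
          ≡⟨ cong (d *_) (v-suc q (suc r)) ⟩
        d * (1 + q * v q (suc r))
          ≡⟨ solve 3 (λ a b w → a :* (con 1 :+ b :* w) := a :+ b :* (a :* w)) refl d q (v q (suc r)) ⟩
        d + q * (d * v q (suc r))
          ≤⟨ +-mono-≤ (m≤n*⌈m/n⌉ d (q ^ suc r) {{m^n≢0 q (suc r)}}) (*-monoʳ-≤ q (d*v≤q^r*griesmer r)) ⟩
        q ^ suc r * ⌈ d / q ^ suc r ⌉ + q * (q ^ r * griesmer q (suc r) d)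
          ≡⟨ solve 4 (λ b p w x → b :* p :* x :+ b :* (p :* w) := b :* p :* (w :+ x)) refl
                     q (q ^ r) (griesmer q (suc r) d) ⌈ d / q ^ suc r ⌉ ⟩
        q ^ suc r * (griesmer q (suc r) d + ⌈ d / q ^ suc r ⌉)
          ∎
        where open ≤-Reasoning

      ⌈griesmer/q^j*v⌉≡⌈d/q^[r+j]⌉ : ∀ r j →
        ⌈ griesmer q (suc r) d / q ^ suc j * v q (suc r) ⌉ ≡ ⌈ d / q ^ (suc r + j) ⌉
      ⌈griesmer/q^j*v⌉≡⌈d/q^[r+j]⌉ r j = ≤-antisym
        (m≤n*o⇒⌈m/n⌉≤o g (q ^ suc j * vᵣ) y (begin
          g                          ≤⟨ d≤q^r*o⇒griesmer≤v*o r (q ^ suc j * y) (begin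
                                          d                          ≤⟨ m≤n*⌈m/n⌉ d (q ^ (suc r + j)) {{m^n≢0 q (suc r + j)}} ⟩
                                          q ^ (suc r + j) * y        ≡⟨ cong (_* y) q^[r+1+j] ⟩
                                          q ^ r * q ^ suc j * y      ≡⟨ *-assoc (q ^ r) _ y ⟩
                                          q ^ r * (q ^ suc j * y)    ∎) ⟩
          vᵣ * (q ^ suc j * y)       ≡⟨ solve 3 (λ a b x → a :* (b :* x) := b :* a :* x) refl vᵣ (q ^ suc j) y ⟩
          q ^ suc j * vᵣ * y         ∎))
        (m≤n*o⇒⌈m/n⌉≤o d (q ^ (suc r + j)) z (*-cancelʳ-≤ d (q ^ (suc r + j) * z) vᵣ {{v-nonZero q r}} (begin
          d * vᵣ                           ≤⟨ d*v≤q^r*griesmer r ⟩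
          q ^ r * g                        ≤⟨ *-monoʳ-≤ (q ^ r) (m≤n*⌈m/n⌉ g (q ^ suc j * vᵣ)
                                                {{m*n≢0 (q ^ suc j) vᵣ {{m^n≢0 q (suc j)}} {{v-nonZero q r}}}}) ⟩
          q ^ r * (q ^ suc j * vᵣ * z)     ≡⟨ solve 4 (λ a b w x → a :* (b :* w :* x) := a :* b :* x :* w) refl
                                                (q ^ r) (q ^ suc j) vᵣ z ⟩
          q ^ r * q ^ suc j * z * vᵣ       ≡⟨ cong (λ t → t * z * vᵣ) q^[r+1+j] ⟨
          q ^ (suc r + j) * z * vᵣ         ∎)))
        where
        open ≤-Reasoning
        g  = griesmer q (suc r) d
        vᵣ = v q (suc r)
        y  = ⌈ d / q ^ (suc r + j) ⌉
        z  = ⌈ g / q ^ suc j * vᵣ ⌉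
        q^[r+1+j] : q ^ (suc r + j) ≡ q ^ r * q ^ suc j
        q^[r+1+j] = trans (cong (q ^_) (sym (+-suc r j))) (^-distribˡ-+-* q r (suc j))

      griesmer-split : ∀ {k r} .{{_ : NonZero r}} → r ≤ k →
        griesmer q k d ≡ griesmer q r d + sumRange 1 (k ∸ r) (λ i → ⌈ griesmer q r d / q ^ i * v q r ⌉)
      griesmer-split {k} {r@(suc r-1)} r≤k = begin
        sumℕ k D                                   ≡⟨ cong (λ m → sumℕ m D) (m+[n∸m]≡n r≤k) ⟨
        sumℕ (r + (k ∸ r)) D                       ≡⟨ sumℕ-+ r (k ∸ r) D ⟩
        griesmer q r d + sumℕ (k ∸ r) (λ j → D (r + j))
          ≡⟨ cong (_+_ (griesmer q r d)) (sumℕ-cong (k ∸ r) (λ j _ → sym (⌈griesmer/q^j*v⌉≡⌈d/q^[r+j]⌉ r-1 j))) ⟩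
        griesmer q r d + sumℕ (k ∸ r) (λ j → ⌈ griesmer q r d / q ^ suc j * v q r ⌉)   ∎
        where
        open ≡-Reasoning
        D : ℕ → ℕ
        D i = ⌈ d / q ^ i ⌉

    module _ {k d : ℕ} .{{_ : NonZero k}} {σ : ℤ} {ε : ℕ → ℕ} (ε≤q-1 : ∀ i → i < k ∸ 1 → ε i ≤ q ∸ 1)
             (d≡σq^[k-1]-∑εq^i : + d ≡ σ ℤ.* + (q ^ (k ∸ 1)) ℤ.- + sumℕ (k ∸ 1) (λ i → ε i * q ^ i)) where
      open ℤ-Solver.+-*-Solver

      -- In the paper's notation d_r = v_r · expansion r − correction r.
      expansion : ℕ → ℤ
      expansion r = σ ℤ.* + (q ^ (k ∸ r)) ℤ.- + sumRange r (k ∸ 1) (λ i → ε (i ∸ 1) * q ^ (i ∸ r))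

      correction : ℕ → ℕ
      correction r = sumRange 1 (r ∸ 1) (λ i → ε (i ∸ 1) * v q i)

      digitTail : ℕ → ℕ
      digitTail r = sumℕ (k ∸ r) (λ j → ε (r + j ∸ 1) * q ^ j)

      sumRange≡digitTail : ∀ r → sumRange r (k ∸ 1) (λ i → ε (i ∸ 1) * q ^ (i ∸ r)) ≡ digitTail r
      sumRange≡digitTail r = trans (cong (λ m → sumℕ (m ∸ r) (λ j → ε (r + j ∸ 1) * q ^ (r + j ∸ r))) (suc-pred k))
        (sumℕ-cong (k ∸ r) (λ j _ → cong (λ t → ε (r + j ∸ 1) * q ^ t) (m+n∸m≡n r j)))

      digitTail-suc : ∀ r → suc (suc r) ≤ k → digitTail (suc r) ≡ ε r + q * digitTail (suc (suc r))
      digitTail-suc r 2+r≤k = begin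
        sumℕ (k ∸ suc r) f                                        ≡⟨ cong (λ m → sumℕ m f) (m∸n≡1+[m∸1+n] 2+r≤k) ⟩
        sumℕ (suc K) f                                            ≡⟨ sumℕ-head K f ⟩
        ε (r + 0) * 1 + sumℕ K (λ j → ε (r + suc j) * (q * q ^ j))
          ≡⟨ cong₂ _+_ (trans (*-identityʳ _) (cong ε (+-identityʳ r)))
                       (sumℕ-cong K (λ j _ → trans (cong (λ t → ε t * (q * q ^ j)) (+-suc r j))
                                                   (*-comm-middle (ε (suc r + j)) q (q ^ j)))) ⟩
        ε r + sumℕ K (λ j → q * (ε (suc r + j) * q ^ j))          ≡⟨ cong (_+_ (ε r)) (*-distribˡ-sumℕ q K _) ⟨
        ε r + q * digitTail (suc (suc r))                         ∎
        where
        open ≡-Reasoning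
        K = k ∸ suc (suc r)
        f : ℕ → ℕ
        f j = ε (suc r + j ∸ 1) * q ^ j
        *-comm-middle : ∀ a b c → a * (b * c) ≡ b * (a * c)
        *-comm-middle a b c = trans (sym (*-assoc a b c)) (trans (cong (_* c) (*-comm a b)) (*-assoc b a c))

      expansion-suc : ∀ r → suc (suc r) ≤ k → expansion (suc r) ≡ + q ℤ.* expansion (suc (suc r)) ℤ.- + ε r
      expansion-suc r 2+r≤k = begin
        σ ℤ.* + (q ^ (k ∸ suc r)) ℤ.- + sumRange (suc r) (k ∸ 1) (λ i → ε (i ∸ 1) * q ^ (i ∸ suc r))
          ≡⟨ cong₂ (λ a b → σ ℤ.* + (q ^ a) ℤ.- + b) (m∸n≡1+[m∸1+n] 2+r≤k)
                   (trans (sumRange≡digitTail (suc r)) (digitTail-suc r 2+r≤k)) ⟩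
        σ ℤ.* + (q * q ^ K) ℤ.- + (ε r + q * digitTail (suc (suc r)))
          ≡⟨ cong₂ (λ a b → σ ℤ.* a ℤ.- b) (ℤₚ.pos-* q (q ^ K))
                   (trans (ℤₚ.pos-+ (ε r) _) (cong (ℤ._+_ (+ ε r)) (ℤₚ.pos-* q _))) ⟩
        σ ℤ.* (+ q ℤ.* + (q ^ K)) ℤ.- (+ ε r ℤ.+ + q ℤ.* + digitTail (suc (suc r)))
          ≡⟨ solve 5 (λ s a b e x → s :* (a :* b) :- (e :+ a :* x) := a :* (s :* b :- x) :- e) refl
                     σ (+ q) (+ (q ^ K)) (+ ε r) (+ digitTail (suc (suc r))) ⟩
        + q ℤ.* (σ ℤ.* + (q ^ K) ℤ.- + digitTail (suc (suc r))) ℤ.- + ε r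
          ≡⟨ cong (λ t → + q ℤ.* (σ ℤ.* + (q ^ K) ℤ.- + t) ℤ.- + ε r) (sumRange≡digitTail (suc (suc r))) ⟨
        + q ℤ.* expansion (suc (suc r)) ℤ.- + ε r
          ∎
        where
        open ≡-Reasoning
        K = k ∸ suc (suc r)

      expansion≡⌈d/q^r⌉ : ∀ r → suc r ≤ k → expansion (suc r) ≡ + ⌈ d / q ^ r ⌉
      expansion≡⌈d/q^r⌉ zero    _     = trans (sym d≡σq^[k-1]-∑εq^i) (cong +_ (sym (⌈m/1⌉≡m d)))
      expansion≡⌈d/q^r⌉ (suc r) 2+r≤k = begin
        expansion (suc (suc r))     ≡⟨ ⌈m/n⌉-unique ⌈ d / q ^ r ⌉ q (ε r) _ (ε≤q-1 r (∸-monoˡ-≤ 1 2+r≤k))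
                                         (trans (sym (expansion≡⌈d/q^r⌉ r (<⇒≤ 2+r≤k))) (expansion-suc r 2+r≤k)) ⟩
        + ⌈ ⌈ d / q ^ r ⌉ / q ⌉     ≡⟨ cong +_ (⌈⌈m/n⌉/o⌉≡⌈m/n*o⌉ d (q ^ r) q {{m^n≢0 q r}} {{q≢0}}) ⟩
        + ⌈ d / q ^ r * q ⌉         ≡⟨ cong (λ t → + ⌈ d / t ⌉) (*-comm (q ^ r) q) ⟩
        + ⌈ d / q ^ suc r ⌉         ∎
        where open ≡-Reasoning

      griesmer≡v*expansion-correction : ∀ r → suc r ≤ k →
        + griesmer q (suc r) d ≡ + v q (suc r) ℤ.* expansion (suc r) ℤ.- + correction (suc r)
      griesmer≡v*expansion-correction zero 1≤k = begin
        + griesmer q 1 d                     ≡⟨ cong +_ (⌈m/1⌉≡m d) ⟩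
        + d                                  ≡⟨ solve 1 (λ x → x := con (+ 1) :* x :- con (+ 0)) refl (+ d) ⟩
        + 1 ℤ.* + d ℤ.- + 0                  ≡⟨ cong (λ t → + 1 ℤ.* t ℤ.- + 0)
                                                     (sym (trans (expansion≡⌈d/q^r⌉ 0 1≤k) (cong +_ (⌈m/1⌉≡m d)))) ⟩
        + 1 ℤ.* expansion 1 ℤ.- + 0          ∎
        where open ≡-Reasoning
      griesmer≡v*expansion-correction (suc r) 2+r≤k = begin
        + (griesmer q (suc r) d + ⌈ d / q ^ suc r ⌉)
          ≡⟨ ℤₚ.pos-+ (griesmer q (suc r) d) _ ⟩
        + griesmer q (suc r) d ℤ.+ + ⌈ d / q ^ suc r ⌉
          ≡⟨ cong₂ ℤ._+_ (griesmer≡v*expansion-correction r (<⇒≤ 2+r≤k)) (sym (expansion≡⌈d/q^r⌉ (suc r) 2+r≤k)) ⟩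
        + vᵣ ℤ.* expansion (suc r) ℤ.- + correction (suc r) ℤ.+ e
          ≡⟨ cong (λ t → + vᵣ ℤ.* t ℤ.- + correction (suc r) ℤ.+ e) (expansion-suc r 2+r≤k) ⟩
        + vᵣ ℤ.* (+ q ℤ.* e ℤ.- + ε r) ℤ.- + correction (suc r) ℤ.+ e
          ≡⟨ solve 5 (λ w a x b c → w :* (a :* x :- b) :- c :+ x := (con (+ 1) :+ a :* w) :* x :- (c :+ b :* w)) refl
                     (+ vᵣ) (+ q) e (+ ε r) (+ correction (suc r)) ⟩
        (+ 1 ℤ.+ + q ℤ.* + vᵣ) ℤ.* e ℤ.- (+ correction (suc r) ℤ.+ + ε r ℤ.* + vᵣ)
          ≡⟨ cong₂ (λ a b → a ℤ.* e ℤ.- b)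
                   (trans (cong (ℤ._+_ (+ 1)) (sym (ℤₚ.pos-* q vᵣ))) (sym (ℤₚ.pos-+ 1 (q * vᵣ))))
                   (trans (cong (ℤ._+_ (+ correction (suc r))) (sym (ℤₚ.pos-* (ε r) vᵣ)))
                          (sym (ℤₚ.pos-+ (correction (suc r)) (ε r * vᵣ)))) ⟩
        + (1 + q * vᵣ) ℤ.* e ℤ.- + (correction (suc r) + ε r * vᵣ)
          ≡⟨ cong (λ t → + t ℤ.* e ℤ.- + (correction (suc r) + ε r * vᵣ)) (v-suc q (suc r)) ⟨
        + v q (suc (suc r)) ℤ.* e ℤ.- + correction (suc (suc r))
          ∎
        where
        open ≡-Reasoning
        vᵣ = v q (suc r)
        e  = expansion (suc (suc r))


module Counting where
  open import Data.Nat using (ℕ; zero; suc; _+_; _*_; _∸_; _≤_; z≤n; s≤s; NonZero)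
  open import Data.Nat.Properties
  open import Data.Bool using (Bool; true; false; _∧_; _∨_; not; if_then_else_)
  open import Data.Fin using (Fin; zero; suc)
  open import Data.Fin.Subset using (Subset; _∈_; ∣_∣)
  open import Data.Fin.Subset.Properties using (⊆-antisym)
  open import Data.Vec using (_∷_; tabulate)
  open import Data.Vec.Properties using ([]=⇒lookup; lookup⇒[]=; lookup∘tabulate)
  open import Data.Product using (∃; _×_; _,_)
  open import Function.Bundles using (_⇔_; Equivalence)
  open import Relation.Binary.PropositionalEquality
  open import Relation.Nullary using (yes; no)
  open import Algebra.Properties.Semiring.Sum +-*-semiring public
    using (sum; sum-cong-≗; sum-replicate-zero; ∑-distrib-+; ∑-comm; *-distribˡ-sum)

  sum-mono-≤ : ∀ {m} {f g : Fin m → ℕ} → (∀ i → f i ≤ g i) → sum f ≤ sum g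
  sum-mono-≤ {zero}  _   = z≤n
  sum-mono-≤ {suc m} f≤g = +-mono-≤ (f≤g zero) (sum-mono-≤ (λ i → f≤g (suc i)))

  ∃-term≤average : ∀ {m} .{{_ : NonZero m}} (f : Fin m → ℕ) → ∃ λ t → m * f t ≤ sum f
  ∃-term≤average {suc zero}    f = zero , ≤-refl
  ∃-term≤average {suc (suc m)} f with ∃-term≤average (λ i → f (suc i))
  ... | t , [1+m]*ft≤∑ with f zero ≤? f (suc t)
  ... | yes f0≤ft = zero , +-monoʳ-≤ (f zero) (≤-trans (*-monoʳ-≤ (suc m) f0≤ft) [1+m]*ft≤∑)
  ... | no  f0≰ft = suc t , +-mono-≤ (<⇒≤ (≰⇒> f0≰ft)) [1+m]*ft≤∑

  ∧-true⁻ : ∀ {a b} → a ∧ b ≡ true → a ≡ true × b ≡ true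
  ∧-true⁻ {true} {true} _ = refl , refl

  ∧-true⁺ : ∀ {a b} → a ≡ true → b ≡ true → a ∧ b ≡ true
  ∧-true⁺ refl refl = refl

  ∨-true⁺ˡ : ∀ {a b} → a ≡ true → a ∨ b ≡ true
  ∨-true⁺ˡ refl = refl

  ∨-true⁺ʳ : ∀ a {b} → b ≡ true → a ∨ b ≡ true
  ∨-true⁺ʳ true  _ = refl
  ∨-true⁺ʳ false b = b

  𝟙 : Bool → ℕ
  𝟙 b = if b then 1 else 0

  count : ∀ {n} → (Fin n → Bool) → ℕ
  count P = sum (λ j → 𝟙 (P j))

  module _ {n : ℕ} where

    count-cong : ∀ {P Q : Fin n → Bool} → (∀ j → P j ≡ Q j) → count P ≡ count Q
    count-cong P≡Q = sum-cong-≗ (λ j → cong 𝟙 (P≡Q j))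

    count-mono-≤ : ∀ {P Q : Fin n → Bool} → (∀ j → P j ≡ true → Q j ≡ true) → count P ≤ count Q
    count-mono-≤ {P} {Q} P⇒Q = sum-mono-≤ (λ j → 𝟙-mono (P⇒Q j))
      where
      𝟙-mono : ∀ {a b} → (a ≡ true → b ≡ true) → 𝟙 a ≤ 𝟙 b
      𝟙-mono {false} _   = z≤n
      𝟙-mono {true}  a⇒b rewrite a⇒b refl = ≤-refl

    count-split : ∀ (P Q : Fin n → Bool) → count P ≡ count (λ j → P j ∧ Q j) + count (λ j → P j ∧ not (Q j))
    count-split P Q = trans (sum-cong-≗ (λ j → 𝟙-split (P j) (Q j)))
                            (∑-distrib-+ (λ j → 𝟙 (P j ∧ Q j)) (λ j → 𝟙 (P j ∧ not (Q j))))
      where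
      𝟙-split : ∀ a b → 𝟙 a ≡ 𝟙 (a ∧ b) + 𝟙 (a ∧ not b)
      𝟙-split false _     = refl
      𝟙-split true  false = refl
      𝟙-split true  true  = refl

    count-∨ : ∀ (P Q : Fin n → Bool) → count (λ j → P j ∨ Q j) ≤ count P + count Q
    count-∨ P Q = ≤-trans (sum-mono-≤ (λ j → 𝟙-∨ (P j) (Q j)))
                          (≤-reflexive (∑-distrib-+ (λ j → 𝟙 (P j)) (λ j → 𝟙 (Q j))))
      where
      𝟙-∨ : ∀ a b → 𝟙 (a ∨ b) ≤ 𝟙 a + 𝟙 b
      𝟙-∨ false _ = ≤-refl
      𝟙-∨ true  _ = s≤s z≤n

  count-true : ∀ n → count {n} (λ _ → true) ≡ n
  count-true zero    = refl
  count-true (suc n) = cong suc (count-true n)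

  count≤n : ∀ {n} (P : Fin n → Bool) → count P ≤ n
  count≤n {n} P = ≤-trans (count-mono-≤ {n} {P} {λ _ → true} (λ _ _ → refl)) (≤-reflexive (count-true n))

  count≤n∸1 : ∀ {n} (P : Fin n → Bool) t → P t ≡ false → count P ≤ n ∸ 1
  count≤n∸1 {suc n}       P zero    Pt≡false rewrite Pt≡false = count≤n (λ i → P (suc i))
  count≤n∸1 {suc (suc n)} P (suc t) Pt≡false =
    ≤-trans (+-monoʳ-≤ (𝟙 (P zero)) (count≤n∸1 (λ i → P (suc i)) t Pt≡false)) (𝟙b+n≤1+n (P zero))
    where
    𝟙b+n≤1+n : ∀ b → 𝟙 b + n ≤ suc n
    𝟙b+n≤1+n false = n≤1+n n
    𝟙b+n≤1+n true  = ≤-refl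

  ∈-tabulate⁺ : ∀ {n} (P : Fin n → Bool) {j} → P j ≡ true → j ∈ tabulate P
  ∈-tabulate⁺ P {j} Pj = lookup⇒[]= j (tabulate P) (trans (lookup∘tabulate P j) Pj)

  ∈-tabulate⁻ : ∀ {n} (P : Fin n → Bool) {j} → j ∈ tabulate P → P j ≡ true
  ∈-tabulate⁻ P {j} j∈ = trans (sym (lookup∘tabulate P j)) ([]=⇒lookup j∈)

  ∣tabulate∣≡count : ∀ {n} (P : Fin n → Bool) → ∣ tabulate P ∣ ≡ count P
  ∣tabulate∣≡count {zero}  P = refl
  ∣tabulate∣≡count {suc n} P = ∣∷∣ (P zero) {tabulate (λ i → P (suc i))} (∣tabulate∣≡count (λ i → P (suc i)))
    where
    ∣∷∣ : ∀ b {p : Subset n} {k} → ∣ p ∣ ≡ k → ∣ b ∷ p ∣ ≡ 𝟙 b + k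
    ∣∷∣ true  ∣p∣≡k = cong suc ∣p∣≡k
    ∣∷∣ false ∣p∣≡k = ∣p∣≡k

  ∣S∣≡count : ∀ {n} (S : Subset n) (P : Fin n → Bool) → (∀ j → j ∈ S ⇔ P j ≡ true) → ∣ S ∣ ≡ count P
  ∣S∣≡count {n} S P S⇔P = trans (cong ∣_∣ S≡tabulateP) (∣tabulate∣≡count P)
    where
    S≡tabulateP : S ≡ tabulate P
    S≡tabulateP = ⊆-antisym {n} (λ j∈S → ∈-tabulate⁺ P (Equivalence.to (S⇔P _) j∈S))
                            (λ j∈P → Equivalence.from (S⇔P _) (∈-tabulate⁻ P j∈P))

module LinearAlgebra {c ℓ} (F : Field c ℓ) where
  open import Data.Nat using (zero; suc)
  open import Data.Fin using (Fin; zero; suc; punchIn; punchOut; _≟_)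
  open import Data.Fin.Properties using (punchIn-punchOut)
  open import Data.Vec.Functional using (Vector; _∷_; tail; insertAt)
  open import Data.Vec.Functional.Properties using (insertAt-lookup; insertAt-punchIn)
  open import Data.Product using (∃; _,_)
  open import Data.Sum using (_⊎_; inj₁; inj₂)
  open import Relation.Nullary using (¬_; yes; no)
  open import Relation.Binary.PropositionalEquality as ≡ using (_≡_)

  open Field F hiding (zero)
  open LinAlg F public
  open import Algebra.Properties.CommutativeSemigroup +-commutativeSemigroup using (interchange)
  open import Data.Vec.Functional.Relation.Binary.Equality.Setoid setoid public using (_≋_)
  open import Relation.Binary.Reasoning.Setoid setoid

  x≉0⇒x*y≈0⇒y≈0 : ∀ {x y} → ¬ (x ≈ 0#) → x * y ≈ 0# → y ≈ 0#
  x≉0⇒x*y≈0⇒y≈0 {x} {y} x≉0 xy≈0 with inverse x x≉0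
  ... | x⁻¹ , xx⁻¹≈1 = begin
    y                ≈⟨ *-identityˡ y ⟨
    1# * y           ≈⟨ *-congʳ xx⁻¹≈1 ⟨
    (x * x⁻¹) * y    ≈⟨ *-congʳ (*-comm x x⁻¹) ⟩
    (x⁻¹ * x) * y    ≈⟨ *-assoc x⁻¹ x y ⟩
    x⁻¹ * (x * y)    ≈⟨ *-congˡ xy≈0 ⟩
    x⁻¹ * 0#         ≈⟨ zeroʳ x⁻¹ ⟩
    0#               ∎

  y≉0⇒x*y≈0⇒x≈0 : ∀ {x y} → ¬ (y ≈ 0#) → x * y ≈ 0# → x ≈ 0#
  y≉0⇒x*y≈0⇒x≈0 {x} {y} y≉0 xy≈0 = x≉0⇒x*y≈0⇒y≈0 y≉0 (trans (*-comm y x) xy≈0)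

  ∃[x]c+x*y≈0 : ∀ c {y} → ¬ (y ≈ 0#) → ∃ λ x → c + x * y ≈ 0#
  ∃[x]c+x*y≈0 c {y} y≉0 with inverse y y≉0
  ... | y⁻¹ , yy⁻¹≈1 = (- c) * y⁻¹ , (begin
    c + ((- c) * y⁻¹) * y   ≈⟨ +-congˡ (*-assoc (- c) y⁻¹ y) ⟩
    c + (- c) * (y⁻¹ * y)   ≈⟨ +-congˡ (*-congˡ (trans (*-comm y⁻¹ y) yy⁻¹≈1)) ⟩
    c + (- c) * 1#          ≈⟨ +-congˡ (*-identityʳ (- c)) ⟩
    c + (- c)               ≈⟨ -‿inverseʳ c ⟩
    0#                      ∎)

  sumF-cong : ∀ {m} {f g : Vector Carrier m} → f ≋ g → sumF f ≈ sumF g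
  sumF-cong {zero}  _   = refl
  sumF-cong {suc m} f≋g = +-cong (f≋g zero) (sumF-cong (λ i → f≋g (suc i)))

  sumF-≈0 : ∀ {m} {f : Vector Carrier m} → (∀ i → f i ≈ 0#) → sumF f ≈ 0#
  sumF-≈0 {zero}  _    = refl
  sumF-≈0 {suc m} f≈0 = trans (+-cong (f≈0 zero) (sumF-≈0 (λ i → f≈0 (suc i)))) (+-identityˡ 0#)

  sumF-distrib-+ : ∀ {m} (f g : Vector Carrier m) → sumF (λ i → f i + g i) ≈ sumF f + sumF g
  sumF-distrib-+ {zero}  f g = sym (+-identityˡ 0#)
  sumF-distrib-+ {suc m} f g = trans (+-congˡ (sumF-distrib-+ (λ i → f (suc i)) (λ i → g (suc i))))
                                     (interchange (f zero) (g zero) _ _)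

  *-distribˡ-sumF : ∀ {m} x (f : Vector Carrier m) → sumF (λ i → x * f i) ≈ x * sumF f
  *-distribˡ-sumF {zero}  x f = sym (zeroʳ x)
  *-distribˡ-sumF {suc m} x f = trans (+-congˡ (*-distribˡ-sumF x (λ i → f (suc i)))) (sym (distribˡ x (f zero) _))

  lincomb-congˡ : ∀ {m n} {a b : Vector Carrier m} (M : Fin m → Fin n → Carrier) → a ≋ b →
                  lincomb a M ≋ lincomb b M
  lincomb-congˡ M a≋b u = sumF-cong (λ i → *-congʳ (a≋b i))

  lincomb-linear : ∀ {m n} (a b : Vector Carrier m) x (M : Fin m → Fin n → Carrier) →
                   lincomb (λ i → a i + x * b i) M ≋ λ u → lincomb a M u + x * lincomb b M u
  lincomb-linear a b x M u = begin
    sumF (λ i → (a i + x * b i) * M i u)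
      ≈⟨ sumF-cong (λ i → distribʳ (M i u) (a i) (x * b i)) ⟩
    sumF (λ i → a i * M i u + (x * b i) * M i u)
      ≈⟨ sumF-distrib-+ (λ i → a i * M i u) (λ i → (x * b i) * M i u) ⟩
    sumF (λ i → a i * M i u) + sumF (λ i → (x * b i) * M i u)
      ≈⟨ +-congˡ (sumF-cong (λ i → *-assoc x (b i) (M i u))) ⟩
    sumF (λ i → a i * M i u) + sumF (λ i → x * (b i * M i u))
      ≈⟨ +-congˡ (*-distribˡ-sumF x (λ i → b i * M i u)) ⟩
    lincomb a M u + x * lincomb b M u ∎

  punchIn-cases : ∀ {m} (i u : Fin (suc m)) → u ≡ i ⊎ ∃ λ j → u ≡ punchIn i j
  punchIn-cases i u with i ≟ u
  ... | yes ≡.refl = inj₁ ≡.refl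
  ... | no  i≢u    = inj₂ (punchOut i≢u , ≡.sym (punchIn-punchOut i≢u))

  insertAt-cong : ∀ {m} (i : Fin (suc m)) {a b : Vector Carrier m} {x y} → a ≋ b → x ≈ y →
                  insertAt a i x ≋ insertAt b i y
  insertAt-cong i {a} {b} {x} {y} a≋b x≈y u with punchIn-cases i u
  ... | inj₁ ≡.refl rewrite insertAt-lookup a i x | insertAt-lookup b i y = x≈y
  ... | inj₂ (j , ≡.refl) rewrite insertAt-punchIn a i x j | insertAt-punchIn b i y j = a≋b j

  insertAt-linear : ∀ {m} (i : Fin (suc m)) (a b : Vector Carrier m) x →
    insertAt (λ k → a k + x * b k) i 0# ≋ λ u → insertAt a i 0# u + x * insertAt b i 0# u
  insertAt-linear i a b x u with punchIn-cases i u
  ... | inj₁ ≡.refl rewrite insertAt-lookup (λ k → a k + x * b k) i 0#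
                          | insertAt-lookup a i 0# | insertAt-lookup b i 0#
      = sym (trans (+-identityˡ _) (zeroʳ x))
  ... | inj₂ (j , ≡.refl) rewrite insertAt-punchIn (λ k → a k + x * b k) i 0# j
                                | insertAt-punchIn a i 0# j | insertAt-punchIn b i 0# j
      = refl

  insertAt-lincomb : ∀ {r m} (i : Fin (suc m)) (b : Vector Carrier r) (B : Fin r → Vector Carrier m) →
    (λ u → sumF (λ t → b t * insertAt (B t) i 0# u)) ≋ insertAt (lincomb b B) i 0#
  insertAt-lincomb i b B u with punchIn-cases i u
  ... | inj₁ ≡.refl rewrite insertAt-lookup (lincomb b B) i 0#
      = sumF-≈0 (λ t → trans (*-congˡ (reflexive (insertAt-lookup (B t) i 0#))) (zeroʳ (b t)))
  ... | inj₂ (j , ≡.refl) rewrite insertAt-punchIn (lincomb b B) i 0# j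
      = sumF-cong (λ t → *-congˡ (reflexive (insertAt-punchIn (B t) i 0# j)))

  lincomb-∷-insertAt : ∀ {m r} (i : Fin (suc m)) (a₀ : Vector Carrier (suc m)) (B′ : Fin r → Vector Carrier m) b →
    lincomb b (a₀ ∷ λ t → insertAt (B′ t) i 0#) ≋ λ u → insertAt (lincomb (tail b) B′) i 0# u + b zero * a₀ u
  lincomb-∷-insertAt i a₀ B′ b u = trans (+-congˡ (insertAt-lincomb i (tail b) B′ u)) (+-comm _ _)

  ∷-insertAt-indep : ∀ {m r} {i : Fin (suc m)} {a₀ : Vector Carrier (suc m)} {B′ : Fin r → Vector Carrier m} →
    ¬ (a₀ i ≈ 0#) → LinIndep B′ → LinIndep (a₀ ∷ λ t → insertAt (B′ t) i 0#)
  ∷-insertAt-indep {m} {r} {i} {a₀} {B′} a₀i≉0 B′-indep b Bb≈0 = all-zero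
    where
    B : Fin (suc r) → Vector Carrier (suc m)
    B = a₀ ∷ λ t → insertAt (B′ t) i 0#
    b₀≈0 : b zero ≈ 0#
    b₀≈0 = y≉0⇒x*y≈0⇒x≈0 a₀i≉0 (begin
      b zero * a₀ i                                           ≈⟨ +-identityˡ _ ⟨
      0# + b zero * a₀ i                                      ≡⟨ ≡.cong (_+ b zero * a₀ i)
                                                                        (insertAt-lookup (lincomb (tail b) B′) i 0#) ⟨
      insertAt (lincomb (tail b) B′) i 0# i + b zero * a₀ i   ≈⟨ lincomb-∷-insertAt i a₀ B′ b i ⟨
      lincomb b B i                                           ≈⟨ Bb≈0 i ⟩
      0#                                                      ∎)
    B′-part≈0 : ∀ u → lincomb (tail b) B′ u ≈ 0#
    B′-part≈0 u = begin
      lincomb (tail b) B′ u                                   ≈⟨ +-identityʳ _ ⟨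
      lincomb (tail b) B′ u + 0#                              ≈⟨ +-congˡ (trans (*-congʳ b₀≈0) (zeroˡ _)) ⟨
      lincomb (tail b) B′ u + b zero * a₀ (punchIn i u)       ≡⟨ ≡.cong (_+ b zero * a₀ (punchIn i u))
                                                                        (insertAt-punchIn (lincomb (tail b) B′) i 0# u) ⟨
      insertAt (lincomb (tail b) B′) i 0# (punchIn i u) + b zero * a₀ (punchIn i u)
                                                              ≈⟨ lincomb-∷-insertAt i a₀ B′ b (punchIn i u) ⟨
      lincomb b B (punchIn i u)                               ≈⟨ Bb≈0 (punchIn i u) ⟩
      0#                                                      ∎
    all-zero : ∀ t → b t ≈ 0#
    all-zero zero    = b₀≈0
    all-zero (suc t) = B′-indep (tail b) B′-part≈0 t

module FiniteField {c ℓ} (F : Field c ℓ) {q : ℕ} (enum : HasOrder F q) where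
  open import Data.Nat using (ℕ; zero; suc; NonZero; _≤_; _≤?_; z≤n)
  open import Data.Nat.Properties using (≤-refl; ≤-trans; ≰⇒>)
  open import Data.Bool using (Bool; true; false; _∧_; _∨_; not)
  open import Data.Fin using (Fin; zero; suc; punchIn)
  open import Data.Fin.Properties using (nonZeroIndex)
  open import Data.Bool.Properties using (∧-identityʳ; ∧-zeroʳ)
  open import Data.Vec.Functional using (Vector; _∷_; insertAt)
  open import Data.Vec.Functional.Properties using (insertAt-lookup; insertAt-punchIn)
  open import Data.Product using (∃; _×_; _,_; proj₁; proj₂)
  open import Relation.Nullary using (¬_; Dec; yes; no; does; contradiction)
  open import Relation.Nullary.Decidable using (dec-true; dec-false)
  open import Relation.Binary.Core using (_Preserves_⟶_)
  open import Relation.Binary.PropositionalEquality as ≡ using (_≡_)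

  open Field F hiding (zero)
  open LinearAlgebra F
  open import Relation.Binary.Reasoning.Setoid setoid

  element : Fin q → Carrier
  element = proj₁ enum

  element-surjective : ∀ x → ∃ λ t → element t ≈ x
  element-surjective = proj₁ (proj₂ enum)

  element-injective : ∀ s t → element s ≈ element t → s ≡ t
  element-injective = proj₂ (proj₂ enum)

  instance
    q-nonZero : NonZero q
    q-nonZero = nonZeroIndex (proj₁ (element-surjective 0#))

  _≈?_ : ∀ x y → Dec (x ≈ y)
  x ≈? y with element-surjective x | element-surjective y
  ... | s , es≈x | t , et≈y with s Data.Fin.≟ t
  ... | yes ≡.refl = yes (trans (sym es≈x) et≈y)
  ... | no  s≢t    = no (λ x≈y → s≢t (element-injective s t (trans es≈x (trans x≈y (sym et≈y)))))

  nz : Carrier → Bool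
  nz x = not (does (x ≈? 0#))

  ≈0⇒¬nz : ∀ {x} → x ≈ 0# → nz x ≡ false
  ≈0⇒¬nz {x} x≈0 = ≡.cong not (dec-true (x ≈? 0#) x≈0)

  ≉0⇒nz : ∀ {x} → ¬ (x ≈ 0#) → nz x ≡ true
  ≉0⇒nz {x} x≉0 = ≡.cong not (dec-false (x ≈? 0#) x≉0)

  nz⇒≉0 : ∀ {x} → nz x ≡ true → ¬ (x ≈ 0#)
  nz⇒≉0 nzx x≈0 with ≡.trans (≡.sym nzx) (≈0⇒¬nz x≈0)
  ... | ()

  ¬nz⇒≈0 : ∀ {x} → nz x ≡ false → x ≈ 0#
  ¬nz⇒≈0 {x} ¬nzx with x ≈? 0#
  ... | yes x≈0 = x≈0
  ¬nz⇒≈0 () | no _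

  nz-cong : ∀ {x y} → x ≈ y → nz x ≡ nz y
  nz-cong {x} {y} x≈y = by-cases (y ≈? 0#)
    where
    by-cases : Dec (y ≈ 0#) → nz x ≡ nz y
    by-cases (yes y≈0) = ≡.trans (≈0⇒¬nz (trans x≈y y≈0)) (≡.sym (≈0⇒¬nz y≈0))
    by-cases (no  y≉0) = ≡.trans (≉0⇒nz (λ x≈0 → y≉0 (trans (sym x≈y) x≈0))) (≡.sym (≉0⇒nz y≉0))

  ∃[t]c+element[t]*y≈0 : ∀ c {y} → ¬ (y ≈ 0#) → ∃ λ t → c + element t * y ≈ 0#
  ∃[t]c+element[t]*y≈0 c y≉0 with ∃[x]c+x*y≈0 c y≉0
  ... | x , c+xy≈0 with element-surjective x
  ... | t , et≈x = t , trans (+-congˡ (*-congʳ et≈x)) c+xy≈0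

  anyFin : ∀ {m} → (Fin m → Bool) → Bool
  anyFin {zero}  P = false
  anyFin {suc m} P = P zero ∨ anyFin (λ i → P (suc i))

  anyFin-sound : ∀ {m} (P : Fin m → Bool) → anyFin P ≡ true → ∃ λ i → P i ≡ true
  anyFin-sound {suc m} P any with P zero in P0
  ... | true  = zero , P0
  ... | false with anyFin-sound (λ i → P (suc i)) any
  ... | i , Pi = suc i , Pi

  anyFin-complete : ∀ {m} (P : Fin m → Bool) i → P i ≡ true → anyFin P ≡ true
  anyFin-complete {suc m} P zero    Pi rewrite Pi = ≡.refl
  anyFin-complete {suc m} P (suc i) Pi with P zero
  ... | true  = ≡.refl
  ... | false = anyFin-complete (λ i → P (suc i)) i Pi

  anyFin-cong : ∀ {m} {P Q : Fin m → Bool} → (∀ i → P i ≡ Q i) → anyFin P ≡ anyFin Q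
  anyFin-cong {zero}  _   = ≡.refl
  anyFin-cong {suc m} P≡Q = ≡.cong₂ _∨_ (P≡Q zero) (anyFin-cong (λ i → P≡Q (suc i)))

  nonzero : ∀ {m} → Vector Carrier m → Bool
  nonzero a = anyFin (λ i → nz (a i))

  nonzero⇒∃≉0 : ∀ {m} (a : Vector Carrier m) → nonzero a ≡ true → ∃ λ i → ¬ (a i ≈ 0#)
  nonzero⇒∃≉0 a nonzero-a with anyFin-sound (λ i → nz (a i)) nonzero-a
  ... | i , nzai = i , nz⇒≉0 nzai

  ≉0⇒nonzero : ∀ {m} (a : Vector Carrier m) i → ¬ (a i ≈ 0#) → nonzero a ≡ true
  ≉0⇒nonzero a i ai≉0 = anyFin-complete (λ i → nz (a i)) i (≉0⇒nz ai≉0)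

  nonzero-cong : ∀ {m} → nonzero {m} Preserves _≋_ ⟶ _≡_
  nonzero-cong a≋b = anyFin-cong (λ i → nz-cong (a≋b i))

  nonzero⇒≉𝟎 : ∀ {m} (a : Vector Carrier m) → nonzero a ≡ true → ¬ (∀ i → a i ≈ 0#)
  nonzero⇒≉𝟎 a nonzero-a a≈0 with nonzero⇒∃≉0 a nonzero-a
  ... | i , ai≉0 = ai≉0 (a≈0 i)

  ≉𝟎⇒nonzero : ∀ {m} (a : Vector Carrier m) → ¬ (∀ i → a i ≈ 0#) → nonzero a ≡ true
  ≉𝟎⇒nonzero a a≉0 with nonzero a in nonzero-a
  ... | true  = ≡.refl
  ... | false = contradiction (λ i → ¬nz⇒≈0 (¬any⇒¬P (λ i → nz (a i)) nonzero-a i)) a≉0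
    where
    ¬any⇒¬P : ∀ {m} (P : Fin m → Bool) → anyFin P ≡ false → ∀ i → P i ≡ false
    ¬any⇒¬P P ¬any i with P i in Pi
    ... | false = ≡.refl
    ... | true with ≡.trans (≡.sym (anyFin-complete P i Pi)) ¬any
    ... | ()

  insertAt+*-nonzero : ∀ {m} {a′ : Vector Carrier m} {i : Fin (suc m)} {a₀ : Vector Carrier (suc m)} →
    nonzero a′ ≡ true → ¬ (a₀ i ≈ 0#) → ∀ x → nonzero (λ u → insertAt a′ i 0# u + x * a₀ u) ≡ true
  insertAt+*-nonzero {a′ = a′} {i} {a₀} a′≢0 a₀i≉0 x = by-cases (x ≈? 0#)
    where
    X : Vector Carrier _
    X u = insertAt a′ i 0# u + x * a₀ u
    by-cases : Dec (x ≈ 0#) → nonzero X ≡ true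
    by-cases (yes x≈0) with nonzero⇒∃≉0 a′ a′≢0
    ... | i′ , a′i′≉0 = ≉0⇒nonzero X (punchIn i i′) (λ Xi′≈0 → a′i′≉0 (begin
      a′ i′                                ≡⟨ insertAt-punchIn a′ i 0# i′ ⟨
      insertAt a′ i 0# (punchIn i i′)      ≈⟨ +-identityʳ _ ⟨
      insertAt a′ i 0# (punchIn i i′) + 0# ≈⟨ +-congˡ (trans (*-congʳ x≈0) (zeroˡ _)) ⟨
      X (punchIn i i′)                     ≈⟨ Xi′≈0 ⟩
      0#                                   ∎))
    by-cases (no x≉0) = ≉0⇒nonzero X i (λ Xi≈0 → a₀i≉0 (x≉0⇒x*y≈0⇒y≈0 x≉0 (begin
      x * a₀ i                             ≈⟨ +-identityˡ _ ⟨
      0# + x * a₀ i                        ≡⟨ ≡.cong (_+ x * a₀ i) (insertAt-lookup a′ i 0#) ⟨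
      X i                                  ≈⟨ Xi≈0 ⟩
      0#                                   ∎)))

  anyVector : ∀ m → (Vector Carrier m → Bool) → Bool
  anyVector zero    Q = Q (λ ())
  anyVector (suc m) Q = anyFin (λ t → anyVector m (λ b → Q (element t ∷ b)))

  anyVector-sound : ∀ m (Q : Vector Carrier m → Bool) → anyVector m Q ≡ true → ∃ λ a → Q a ≡ true
  anyVector-sound zero    Q Q[] = (λ ()) , Q[]
  anyVector-sound (suc m) Q any with anyFin-sound _ any
  ... | t , any′ with anyVector-sound m (λ b → Q (element t ∷ b)) any′
  ... | b , Q[t∷b] = (element t ∷ b) , Q[t∷b]

  anyVector-complete : ∀ m (Q : Vector Carrier m → Bool) → Q Preserves _≋_ ⟶ _≡_ →
                       ∀ a → Q a ≡ true → anyVector m Q ≡ true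
  anyVector-complete zero    Q Q-cong a Qa = ≡.trans (Q-cong (λ ())) Qa
  anyVector-complete (suc m) Q Q-cong a Qa with element-surjective (a zero)
  ... | t , et≈a0 = anyFin-complete _ t
    (anyVector-complete m (λ b → Q (element t ∷ b)) (λ b≋b′ → Q-cong (λ { zero → refl ; (suc i) → b≋b′ i }))
                        (λ i → a (suc i)) (≡.trans (Q-cong t∷a′≋a) Qa))
    where
    t∷a′≋a : (element t ∷ λ i → a (suc i)) ≋ a
    t∷a′≋a zero    = et≈a0
    t∷a′≋a (suc i) = refl

  ∃-minimal : ∀ {m} (Q : Vector Carrier m → Bool) (f : Vector Carrier m → ℕ) →
              Q Preserves _≋_ ⟶ _≡_ → f Preserves _≋_ ⟶ _≡_ →
              ∀ a → Q a ≡ true → ∃ λ a₀ → Q a₀ ≡ true × (∀ b → Q b ≡ true → f a₀ ≤ f b)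
  ∃-minimal {m} Q f Q-cong f-cong a Qa = descend (f a) a Qa ≤-refl
    where
    Q∧f≤ : ℕ → Vector Carrier m → Bool
    Q∧f≤ N b = Q b ∧ does (f b ≤? N)

    Q∧f≤-cong : ∀ N → Q∧f≤ N Preserves _≋_ ⟶ _≡_
    Q∧f≤-cong N a≋b = ≡.cong₂ (λ u w → u ∧ does (w ≤? N)) (Q-cong a≋b) (f-cong a≋b)

    Q∧f≤-sound : ∀ {N} b → Q∧f≤ N b ≡ true → Q b ≡ true × f b ≤ N
    Q∧f≤-sound {N} b = by-cases (f b ≤? N)
      where
      by-cases : (fb≤?N : Dec (f b ≤ N)) → Q b ∧ does fb≤?N ≡ true → Q b ≡ true × f b ≤ N
      by-cases (yes fb≤N) Qb∧true  = ≡.trans (≡.sym (∧-identityʳ (Q b))) Qb∧true , fb≤N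
      by-cases (no  _)    Qb∧false = contradiction (≡.trans (≡.sym (∧-zeroʳ (Q b))) Qb∧false) λ ()

    descend : ∀ N a → Q a ≡ true → f a ≤ N → ∃ λ a₀ → Q a₀ ≡ true × (∀ b → Q b ≡ true → f a₀ ≤ f b)
    descend zero    a Qa fa≤0 = a , Qa , λ b _ → ≤-trans fa≤0 z≤n
    descend (suc N) a Qa fa≤1+N with anyVector m (Q∧f≤ N) in smaller
    ... | true with anyVector-sound m (Q∧f≤ N) smaller
    ...   | b , Q∧f≤Nb = descend N b (proj₁ (Q∧f≤-sound b Q∧f≤Nb)) (proj₂ (Q∧f≤-sound b Q∧f≤Nb))
    descend (suc N) a Qa fa≤1+N | false = a , Qa , minimal
      where
      minimal : ∀ b → Q b ≡ true → f a ≤ f b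
      minimal b Qb with f b ≤? N
      ... | no  fb≰N = ≤-trans fa≤1+N (≰⇒> fb≰N)
      ... | yes fb≤N with ≡.trans (≡.sym (anyVector-complete m (Q∧f≤ N) (Q∧f≤-cong N) b
                                            (≡.cong₂ _∧_ Qb (dec-true (f b ≤? N) fb≤N)))) smaller
      ...   | ()

module LinearCodes {a ℓ} (F : Field a ℓ) {q : ℕ} (enum : HasOrder F q) (n : ℕ) where
  open import Level using (_⊔_)
  open import Data.Nat as ℕ using (zero; suc; _∸_; _≤_; z≤n; s≤s)
  import Data.Nat.Properties as ℕₚ
  open ℕₚ using (≤-reflexive; ≤-trans; ≤-antisym; +-mono-≤; +-cancelˡ-≤; module ≤-Reasoning)
  open import Data.Bool using (Bool; true; false; _∧_; _∨_; not)
  open import Data.Bool.Properties using (∧-commutativeMonoid; ∧-zeroʳ)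
  open import Algebra.Bundles using (CommutativeMonoid)
  open import Algebra.Properties.CommutativeSemigroup (CommutativeMonoid.commutativeSemigroup ∧-commutativeMonoid)
    using (xy∙z≈xz∙y)
  open import Data.Fin using (Fin; zero; suc; punchIn)
  open import Data.Vec.Functional using (Vector; _∷_; tail; insertAt)
  open import Data.Vec.Functional.Properties using (insertAt-lookup; insertAt-punchIn)
  open import Data.Product using (∃; ∃₂; _×_; _,_; proj₁; proj₂)
  open import Relation.Nullary using (¬_)
  open import Relation.Binary.Core using (_Preserves_⟶_)
  open import Function using (_∘_)
  open import Relation.Binary.PropositionalEquality as ≡ using (_≡_)

  open Field F hiding (zero)
  open LinearAlgebra F
  open FiniteField F enum
  open Counting
  open Arithmetic
  open import Algebra.Properties.Group +-group using (identityˡ-unique)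
  import Relation.Binary.Reasoning.Setoid as SetoidReasoning
  module ≈-Reasoning = SetoidReasoning setoid

  Word : Set a
  Word = Vector Carrier n

  weight : (Fin n → Bool) → Word → ℕ
  weight T x = count (λ j → T j ∧ nz (x j))

  weight-cong : ∀ T {x y} → x ≋ y → weight T x ≡ weight T y
  weight-cong T x≋y = count-cong (λ j → ≡.cong (T j ∧_) (nz-cong (x≋y j)))

  _∖supp_ : (Fin n → Bool) → Word → Fin n → Bool
  (T ∖supp c) j = T j ∧ not (nz (c j))

  weight-split : ∀ T (c c₀ : Word) x →
    weight T (λ j → c j + x * c₀ j)
      ≡ count (λ j → (T j ∧ nz (c₀ j)) ∧ nz (c j + x * c₀ j)) ℕ.+ weight (T ∖supp c₀) c
  weight-split T c c₀ x = ≡.trans (count-split (λ j → T j ∧ nz (y j)) (λ j → nz (c₀ j)))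
    (≡.cong₂ ℕ._+_ (count-cong (λ j → xy∙z≈xz∙y (T j) (nz (y j)) (nz (c₀ j)))) (count-cong off-support))
    where
    y : Word
    y j = c j + x * c₀ j
    off-support : ∀ j → (T j ∧ nz (y j)) ∧ not (nz (c₀ j)) ≡ (T j ∧ not (nz (c₀ j))) ∧ nz (c j)
    off-support j with nz (c₀ j) in nz-c₀j
    ... | true  = ≡.trans (∧-zeroʳ (T j ∧ nz (y j))) (≡.sym (≡.cong (_∧ nz (c j)) (∧-zeroʳ (T j))))
    ... | false = ≡.trans (xy∙z≈xz∙y (T j) (nz (y j)) true) (≡.cong ((T j ∧ true) ∧_) (nz-cong yj≈cj))
      where
      yj≈cj : y j ≈ c j
      yj≈cj = trans (+-congˡ (trans (*-congˡ (¬nz⇒≈0 nz-c₀j)) (zeroʳ x))) (+-identityʳ (c j))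

  -- For each j in the support of c₀ some t makes c j + element t * c₀ j vanish.
  ∑-count≤[q∸1]*weight : ∀ T (c c₀ : Word) →
    sum (λ t → count (λ j → (T j ∧ nz (c₀ j)) ∧ nz (c j + element t * c₀ j))) ≤ (q ∸ 1) ℕ.* weight T c₀
  ∑-count≤[q∸1]*weight T c c₀ = begin
    sum (λ t → sum (λ j → 𝟙 (P t j)))            ≡⟨ ∑-comm (λ t j → 𝟙 (P t j)) ⟩
    sum (λ j → sum (λ t → 𝟙 (P t j)))            ≤⟨ sum-mono-≤ at-most-q∸1 ⟩
    sum (λ j → (q ∸ 1) ℕ.* 𝟙 (T j ∧ nz (c₀ j)))  ≡⟨ *-distribˡ-sum (q ∸ 1) (λ j → 𝟙 (T j ∧ nz (c₀ j))) ⟨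
    (q ∸ 1) ℕ.* weight T c₀                      ∎
    where
    open ℕₚ.≤-Reasoning
    P : Fin q → Fin n → Bool
    P t j = (T j ∧ nz (c₀ j)) ∧ nz (c j + element t * c₀ j)
    none : sum {q} (λ _ → 0) ≤ (q ∸ 1) ℕ.* 0
    none = ≤-reflexive (≡.trans (sum-replicate-zero q) (≡.sym (ℕₚ.*-zeroʳ (q ∸ 1))))
    at-most-q∸1 : ∀ j → sum (λ t → 𝟙 (P t j)) ≤ (q ∸ 1) ℕ.* 𝟙 (T j ∧ nz (c₀ j))
    at-most-q∸1 j with T j
    ... | false = none
    ... | true with nz (c₀ j) in nz-c₀j
    ...   | false = none
    ...   | true with ∃[t]c+element[t]*y≈0 (c j) (nz⇒≉0 nz-c₀j)
    ...     | t₀ , vanishes = ≤-trans (count≤n∸1 (λ t → nz (c j + element t * c₀ j)) t₀ (≈0⇒¬nz vanishes))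
                                      (≤-reflexive (≡.sym (ℕₚ.*-identityʳ (q ∸ 1))))

  record LinearCode (m : ℕ) : Set (a ⊔ ℓ) where
    field
      encode           : Vector Carrier m → Word
      encode-cong      : ∀ {a b} → a ≋ b → encode a ≋ encode b
      encode-linear    : ∀ a b x → encode (λ i → a i + x * b i) ≋ λ j → encode a j + x * encode b j
      encode-injective : ∀ a → (∀ j → encode a j ≈ 0#) → ∀ i → a i ≈ 0#

    encode-𝟎 : ∀ j → encode (λ _ → 0#) j ≈ 0#
    encode-𝟎 j = identityˡ-unique y y (begin
      y + y                              ≈⟨ +-congˡ (*-identityˡ y) ⟨
      y + 1# * y                         ≈⟨ encode-linear 𝟎 𝟎 1# j ⟨
      encode (λ _ → 0# + 1# * 0#) j      ≈⟨ encode-cong (λ _ → trans (+-congˡ (zeroʳ 1#)) (+-identityʳ 0#)) j ⟩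
      y                                  ∎)
      where
      open ≈-Reasoning
      𝟎 : Vector Carrier m
      𝟎 _ = 0#
      y = encode 𝟎 j

    encode-scale : ∀ x a j → encode (λ u → x * a u) j ≈ x * encode a j
    encode-scale x a j = begin
      encode (λ u → x * a u) j            ≈⟨ encode-cong (λ u → +-identityˡ (x * a u)) j ⟨
      encode (λ u → 0# + x * a u) j       ≈⟨ encode-linear (λ _ → 0#) a x j ⟩
      encode (λ _ → 0#) j + x * encode a j ≈⟨ +-congʳ (encode-𝟎 j) ⟩
      0# + x * encode a j                 ≈⟨ +-identityˡ _ ⟩
      x * encode a j                      ∎
      where open ≈-Reasoning

    nz-encode-cong : ∀ j → (λ a → nz (encode a j)) Preserves _≋_ ⟶ _≡_
    nz-encode-cong j a≋b = nz-cong (encode-cong a≋b j)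

  open LinearCode

  subcode : ∀ {m r} (C : LinearCode m) (B : Fin r → Vector Carrier m) → LinIndep B → LinearCode r
  subcode C B B-indep = record
    { encode           = λ b → encode C (lincomb b B)
    ; encode-cong      = λ b≋b′ → encode-cong C (lincomb-congˡ B b≋b′)
    ; encode-linear    = λ a b x j → trans (encode-cong C (lincomb-linear a b x B) j)
                                           (encode-linear C (lincomb a B) (lincomb b B) x j)
    ; encode-injective = λ b Bb≈0 → B-indep b (encode-injective C (lincomb b B) Bb≈0)
    }

  vanishingAt : ∀ {m} → LinearCode (suc m) → Fin (suc m) → LinearCode m
  vanishingAt C i = record
    { encode           = λ a → encode C (insertAt a i 0#)
    ; encode-cong      = λ a≋b → encode-cong C (insertAt-cong i a≋b refl)
    ; encode-linear    = λ a b x j → trans (encode-cong C (insertAt-linear i a b x) j) (encode-linear C _ _ x j)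
    ; encode-injective = λ a a≈0 u → ≡.subst (_≈ 0#) (insertAt-punchIn a i 0# u)
                                       (encode-injective C (insertAt a i 0#) a≈0 (punchIn i u))
    }

  support : ∀ {m} → LinearCode m → (Fin n → Bool) → Fin n → Bool
  support {m} C T j = T j ∧ anyVector m (λ a → nz (encode C a j))

  MinWeightAtLeast : ∀ {m} → LinearCode m → (Fin n → Bool) → ℕ → Set a
  MinWeightAtLeast C T δ = ∀ a → nonzero a ≡ true → δ ≤ weight T (encode C a)

  IsMinimumWeight : ∀ {m} → LinearCode m → (Fin n → Bool) → Vector Carrier m → Set a
  IsMinimumWeight C T a₀ = nonzero a₀ ≡ true × MinWeightAtLeast C T (weight T (encode C a₀))

  minimumWeightWord : ∀ {m} (C : LinearCode (suc m)) T → ∃ (IsMinimumWeight C T)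
  minimumWeightWord {m} C T = ∃-minimal nonzero (λ a → weight T (encode C a)) nonzero-cong
    (λ a≋b → weight-cong T (encode-cong C a≋b))
    (λ _ → 1#) (≉0⇒nonzero {suc m} (λ _ → 1#) zero (λ 1≈0 → 0≉1 (sym 1≈0)))

  support-complete : ∀ {m} (C : LinearCode m) T {j} a → T j ≡ true → nz (encode C a j) ≡ true →
                     support C T j ≡ true
  support-complete {m} C T a Tj nz-aj = ∧-true⁺ Tj (anyVector-complete m _ (nz-encode-cong C _) a nz-aj)

  -- Some c + t c₀ (t ∈ F) is nonzero on at most a fraction (q - 1)/q of the support of c₀, yet has
  -- weight at least d₀; the rest of its weight lies outside the support of c₀, where it agrees with c.
  residual-minWeight : ∀ {m} (C : LinearCode (suc m)) T {a₀ i} → IsMinimumWeight C T a₀ → ¬ (a₀ i ≈ 0#) →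
    MinWeightAtLeast (vanishingAt C i) (T ∖supp encode C a₀) ⌈ weight T (encode C a₀) / q ⌉
  residual-minWeight {m} C T {a₀} {i} (_ , a₀-minimal) a₀i≉0 a′ a′≢0 =
    m≤e+o⇒⌈m/n⌉≤o (≤-trans (proj₂ (∃-term≤average f)) (∑-count≤[q∸1]*weight T c c₀))
                  (d₀≤f[t]+weight (proj₁ (∃-term≤average f)))
    where
    A : Vector Carrier (suc m)
    A = insertAt a′ i 0#
    c c₀ : Word
    c  = encode C A
    c₀ = encode C a₀
    f : Fin q → ℕ
    f t = count (λ j → (T j ∧ nz (c₀ j)) ∧ nz (c j + element t * c₀ j))
    X : Fin q → Vector Carrier (suc m)
    X t u = A u + element t * a₀ u

    d₀≤f[t]+weight : ∀ t → weight T c₀ ≤ f t ℕ.+ weight (T ∖supp c₀) c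
    d₀≤f[t]+weight t = ≤-trans (a₀-minimal (X t) (insertAt+*-nonzero {a′ = a′} {i} {a₀} a′≢0 a₀i≉0 (element t)))
      (≤-reflexive (≡.trans (weight-cong T (encode-linear C A a₀ (element t))) (weight-split T c c₀ (element t))))

  support-split : ∀ {m} (C : LinearCode (suc m)) T a₀ i →
    weight T (encode C a₀) ℕ.+ count (support (vanishingAt C i) (T ∖supp encode C a₀)) ≤ count (support C T)
  support-split {m} C T a₀ i = begin
    weight T c₀ ℕ.+ count (support (vanishingAt C i) (T ∖supp c₀))
      ≤⟨ +-mono-≤ (count-mono-≤ on-support) (count-mono-≤ off-support) ⟩
    count (λ j → support C T j ∧ nz (c₀ j)) ℕ.+ count (λ j → support C T j ∧ not (nz (c₀ j)))
      ≡⟨ count-split (support C T) (λ j → nz (c₀ j)) ⟨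
    count (support C T)
      ∎
    where
    open ℕₚ.≤-Reasoning
    c₀ : Word
    c₀ = encode C a₀
    on-support : ∀ j → T j ∧ nz (c₀ j) ≡ true → support C T j ∧ nz (c₀ j) ≡ true
    on-support j Tj∧nz with ∧-true⁻ Tj∧nz
    ... | Tj , nz-c₀j = ∧-true⁺ (support-complete C T a₀ Tj nz-c₀j) nz-c₀j
    off-support : ∀ j → support (vanishingAt C i) (T ∖supp c₀) j ≡ true → support C T j ∧ not (nz (c₀ j)) ≡ true
    off-support j in-support′ with ∧-true⁻ in-support′
    ... | T′j , any′ with ∧-true⁻ T′j | anyVector-sound m _ any′
    ... | Tj , ¬nz-c₀j | a′ , nz-a′j = ∧-true⁺ (support-complete C T (insertAt a′ i 0#) Tj nz-a′j) ¬nz-c₀j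

  griesmer-bound : ∀ m (C : LinearCode m) T δ → MinWeightAtLeast C T δ → griesmer q m δ ≤ count (support C T)
  griesmer-bound zero    C T δ _     = z≤n
  griesmer-bound (suc m) C T δ min≥δ with minimumWeightWord C T
  ... | a₀ , a₀-minimum with nonzero⇒∃≉0 a₀ (proj₁ a₀-minimum)
  ... | i , a₀i≉0 = begin
    griesmer q (suc m) δ                   ≡⟨ griesmer-suc q m δ ⟩
    δ ℕ.+ griesmer q m ⌈ δ / q ⌉           ≤⟨ +-mono-≤ δ≤d₀ (griesmer-bound m (vanishingAt C i) _ _ residual≥⌈δ/q⌉) ⟩
    weight T (encode C a₀) ℕ.+ count (support (vanishingAt C i) (T ∖supp encode C a₀))
                                           ≤⟨ support-split C T a₀ i ⟩
    count (support C T)                    ∎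
    where
    open ℕₚ.≤-Reasoning
    δ≤d₀ : δ ≤ weight T (encode C a₀)
    δ≤d₀ = min≥δ a₀ (proj₁ a₀-minimum)
    residual≥⌈δ/q⌉ : MinWeightAtLeast (vanishingAt C i) (T ∖supp encode C a₀) ⌈ δ / q ⌉
    residual≥⌈δ/q⌉ a′ a′≢0 = ≤-trans (⌈m/n⌉-monoˡ-≤ q δ≤d₀) (residual-minWeight C T a₀-minimum a₀i≉0 a′ a′≢0)

  SmallSubcode : ∀ {m} → LinearCode m → (Fin n → Bool) → ℕ → ℕ → Set (a ⊔ ℓ)
  SmallSubcode {m} C T δ r = ∃₂ λ (B : Fin r → Vector Carrier m) (B-indep : LinIndep B) →
    count (support (subcode C B B-indep) T) ≤ griesmer q r δ

  lineSubcode : ∀ {m δ} (C : LinearCode m) T {a₀ i} → ¬ (a₀ i ≈ 0#) → weight T (encode C a₀) ≤ δ →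
                SmallSubcode C T δ 1
  lineSubcode {δ = δ} C T {a₀} {i} a₀i≉0 d₀≤δ =
    (λ _ → a₀) , a₀-indep , ≤-trans (count-mono-≤ covered) (≤-trans d₀≤δ (≤-reflexive (≡.sym (⌈m/1⌉≡m δ))))
    where
    a₀-indep : LinIndep (λ (_ : Fin 1) → a₀)
    a₀-indep b ba₀≈0 zero = y≉0⇒x*y≈0⇒x≈0 a₀i≉0 (trans (sym (+-identityʳ _)) (ba₀≈0 i))
    covered : ∀ j → support (subcode C (λ _ → a₀) a₀-indep) T j ≡ true → T j ∧ nz (encode C a₀ j) ≡ true
    covered j in-support with ∧-true⁻ in-support
    ... | Tj , any with anyVector-sound 1 _ any
    ... | b , nz-bj = ∧-true⁺ Tj (≉0⇒nz (λ c₀j≈0 → nz⇒≉0 nz-bj (begin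
      encode C (lincomb b (λ _ → a₀)) j   ≈⟨ encode-cong C (λ u → +-identityʳ (b zero * a₀ u)) j ⟩
      encode C (λ u → b zero * a₀ u) j    ≈⟨ encode-scale C (b zero) a₀ j ⟩
      b zero * encode C a₀ j              ≈⟨ *-congˡ c₀j≈0 ⟩
      b zero * 0#                         ≈⟨ zeroʳ _ ⟩
      0#                                  ∎)))
      where open ≈-Reasoning

  extendSubcode : ∀ {m r δ} (C : LinearCode (suc m)) T {a₀ i} → ¬ (a₀ i ≈ 0#) → weight T (encode C a₀) ≤ δ →
    SmallSubcode (vanishingAt C i) (T ∖supp encode C a₀) ⌈ δ / q ⌉ r → SmallSubcode C T δ (suc r)
  extendSubcode {m} {r} {δ} C T {a₀} {i} a₀i≉0 d₀≤δ (B′ , B′-indep , small′) = B , B-indep , small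
    where
    c₀ : Word
    c₀ = encode C a₀
    T′ : Fin n → Bool
    T′ = T ∖supp c₀
    C′ : LinearCode r
    C′ = subcode (vanishingAt C i) B′ B′-indep
    B : Fin (suc r) → Vector Carrier (suc m)
    B = a₀ ∷ λ t → insertAt (B′ t) i 0#
    B-indep : LinIndep B
    B-indep = ∷-insertAt-indep a₀i≉0 B′-indep

    covered : ∀ j → support (subcode C B B-indep) T j ≡ true → (T j ∧ nz (c₀ j)) ∨ support C′ T′ j ≡ true
    covered j in-support with ∧-true⁻ in-support
    ... | Tj , any with anyVector-sound (suc r) _ any
    ... | b , nz-bj = by-cases (nz (c₀ j)) ≡.refl
      where
      open ≈-Reasoning
      by-cases : ∀ β → nz (c₀ j) ≡ β → (T j ∧ nz (c₀ j)) ∨ support C′ T′ j ≡ true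
      by-cases true  nz-c₀j = ∨-true⁺ˡ (∧-true⁺ Tj nz-c₀j)
      by-cases false nz-c₀j = ∨-true⁺ʳ (T j ∧ nz (c₀ j))
        (support-complete C′ T′ (tail b) (∧-true⁺ Tj (≡.cong not nz-c₀j))
                          (≡.trans (nz-cong (sym encode-B≈encode-C′)) nz-bj))
        where
        encode-B≈encode-C′ : encode C (lincomb b B) j ≈ encode C′ (tail b) j
        encode-B≈encode-C′ = begin
          encode C (lincomb b B) j              ≈⟨ trans (encode-cong C (lincomb-∷-insertAt i a₀ B′ b) j)
                                                         (encode-linear C _ a₀ (b zero) j) ⟩
          encode C′ (tail b) j + b zero * c₀ j  ≈⟨ +-congˡ (*-congˡ (¬nz⇒≈0 nz-c₀j)) ⟩
          encode C′ (tail b) j + b zero * 0#    ≈⟨ +-congˡ (zeroʳ _) ⟩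
          encode C′ (tail b) j + 0#             ≈⟨ +-identityʳ _ ⟩
          encode C′ (tail b) j                  ∎

    small : count (support (subcode C B B-indep) T) ≤ griesmer q (suc r) δ
    small = begin
      count (support (subcode C B B-indep) T)                       ≤⟨ count-mono-≤ covered ⟩
      count (λ j → (T j ∧ nz (c₀ j)) ∨ support C′ T′ j)             ≤⟨ count-∨ (λ j → T j ∧ nz (c₀ j)) (support C′ T′) ⟩
      weight T c₀ ℕ.+ count (support C′ T′)                          ≤⟨ +-mono-≤ d₀≤δ small′ ⟩
      δ ℕ.+ griesmer q r ⌈ δ / q ⌉                                   ≡⟨ griesmer-suc q r δ ⟨
      griesmer q (suc r) δ                                          ∎
      where open ℕₚ.≤-Reasoning

  -- A code meeting the Griesmer bound on T has minimum weight exactly δ, and its residual code with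
  -- respect to a minimum weight word again meets the Griesmer bound.
  griesmerCode-subcodes : ∀ m (C : LinearCode m) T δ → MinWeightAtLeast C T δ → count T ≤ griesmer q m δ →
                          ∀ r → 1 ≤ r → r ≤ m → SmallSubcode C T δ r
  griesmerCode-subcodes zero    C T δ _     _     (suc _) _ ()
  griesmerCode-subcodes (suc m) C T δ min≥δ |T|≤g r 1≤r r≤1+m with minimumWeightWord C T
  ... | a₀ , a₀-minimum with nonzero⇒∃≉0 a₀ (proj₁ a₀-minimum)
  ... | i , a₀i≉0 = subcodes r 1≤r r≤1+m
    where
    open ℕₚ.≤-Reasoning
    c₀ : Word
    c₀ = encode C a₀

    d₀≤δ : weight T c₀ ≤ δ
    d₀≤δ = griesmer-cancel-≤ q m (begin
      griesmer q (suc m) (weight T c₀)   ≤⟨ griesmer-bound (suc m) C T _ (proj₂ a₀-minimum) ⟩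
      count (support C T)                ≤⟨ count-mono-≤ {P = support C T} {Q = T} (λ j → proj₁ ∘ ∧-true⁻) ⟩
      count T                            ≤⟨ |T|≤g ⟩
      griesmer q (suc m) δ               ∎)

    d₀≡δ : weight T c₀ ≡ δ
    d₀≡δ = ≤-antisym d₀≤δ (min≥δ a₀ (proj₁ a₀-minimum))

    residual≥⌈δ/q⌉ : MinWeightAtLeast (vanishingAt C i) (T ∖supp c₀) ⌈ δ / q ⌉
    residual≥⌈δ/q⌉ = ≡.subst (λ d → MinWeightAtLeast (vanishingAt C i) (T ∖supp c₀) ⌈ d / q ⌉) d₀≡δ
                              (residual-minWeight C T a₀-minimum a₀i≉0)

    |T′|≤g : count (T ∖supp c₀) ≤ griesmer q m ⌈ δ / q ⌉
    |T′|≤g = +-cancelˡ-≤ δ _ _ (begin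
      δ ℕ.+ count (T ∖supp c₀)             ≡⟨ ≡.cong (ℕ._+ count (T ∖supp c₀)) d₀≡δ ⟨
      weight T c₀ ℕ.+ count (T ∖supp c₀)   ≡⟨ count-split T (λ j → nz (c₀ j)) ⟨
      count T                              ≤⟨ |T|≤g ⟩
      griesmer q (suc m) δ                 ≡⟨ griesmer-suc q m δ ⟩
      δ ℕ.+ griesmer q m ⌈ δ / q ⌉         ∎)

    subcodes : ∀ r → 1 ≤ r → r ≤ suc m → SmallSubcode C T δ r
    subcodes (suc zero)    _ _         = lineSubcode C T a₀i≉0 d₀≤δ
    subcodes (suc (suc r)) _ (s≤s r<m) = extendSubcode C T a₀i≉0 d₀≤δ
      (griesmerCode-subcodes m (vanishingAt C i) (T ∖supp c₀) ⌈ δ / q ⌉ residual≥⌈δ/q⌉ |T′|≤g (suc r) (s≤s z≤n) r<m)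

module GeneralizedHammingWeights {a ℓ} (F : Field a ℓ) {q : ℕ} (enum : HasOrder F q)
  {k n : ℕ} (G : Fin k → Fin n → Field.Carrier F) (G-indep : LinAlg.LinIndep F G) where
  open import Data.Nat using (_≤_)
  open import Data.Nat.Properties using (≤-refl; ≤-trans; ≤-reflexive; ≤-antisym)
  open import Data.Bool using (Bool; true)
  open import Data.Fin using (Fin; zero)
  open import Data.Fin.Subset using (Subset; _∈_; ∣_∣)
  open import Data.Vec using (tabulate)
  open import Data.Product using (∃; _,_)
  open import Function.Bundles using (_⇔_; mk⇔; Equivalence)
  open import Relation.Nullary using (¬_)
  open import Relation.Binary.PropositionalEquality as ≡ using (_≡_)

  open Field F hiding (zero)
  open LinearAlgebra F
  open FiniteField F enum
  open Counting
  open LinearCodes F enum n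
  open Arithmetic using (⌈m/1⌉≡m)

  code : LinearCode k
  code = record
    { encode           = λ x → lincomb x G
    ; encode-cong      = lincomb-congˡ G
    ; encode-linear    = λ x y z → lincomb-linear x y z G
    ; encode-injective = G-indep
    }

  everywhere : Fin n → Bool
  everywhere _ = true

  subcodeSupport : ∀ {r} → (Fin r → Fin k → Carrier) → Fin n → Bool
  subcodeSupport {r} U j = anyVector r (λ b → nz (subcodeWord G U b j))

  subcodeSupport⇔ : ∀ {r} (U : Fin r → Fin k → Carrier) j →
                    subcodeSupport U j ≡ true ⇔ ∃ λ b → ¬ (subcodeWord G U b j ≈ 0#)
  subcodeSupport⇔ {r} U j = mk⇔ sound complete
    where
    sound : subcodeSupport U j ≡ true → ∃ λ b → ¬ (subcodeWord G U b j ≈ 0#)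
    sound any with anyVector-sound r _ any
    ... | b , nz-bj = b , nz⇒≉0 nz-bj
    complete : (∃ λ b → ¬ (subcodeWord G U b j ≈ 0#)) → subcodeSupport U j ≡ true
    complete (b , bj≉0) = anyVector-complete r _ (λ b≋b′ → nz-cong (lincomb-congˡ G (lincomb-congˡ U b≋b′) j)) b
                                             (≉0⇒nz bj≉0)

  isSupport-tabulate : ∀ {r} (U : Fin r → Fin k → Carrier) → IsSupport G U (tabulate (subcodeSupport U))
  isSupport-tabulate U j = mk⇔
    (λ j∈ → Equivalence.to (subcodeSupport⇔ U j) (∈-tabulate⁻ (subcodeSupport U) j∈))
    (λ ∃b → ∈-tabulate⁺ (subcodeSupport U) (Equivalence.from (subcodeSupport⇔ U j) ∃b))

  ∣S∣≡count-subcodeSupport : ∀ {r} (U : Fin r → Fin k → Carrier) S → IsSupport G U S →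
                             ∣ S ∣ ≡ count (subcodeSupport U)
  ∣S∣≡count-subcodeSupport U S S-supp = ∣S∣≡count S (subcodeSupport U) (λ j → mk⇔
    (λ j∈S → Equivalence.from (subcodeSupport⇔ U j) (Equivalence.to (S-supp j) j∈S))
    (λ in-supp → Equivalence.from (S-supp j) (Equivalence.to (subcodeSupport⇔ U j) in-supp)))

  minWeight≥d : ∀ {d} → IsGHW G 1 d → MinWeightAtLeast code everywhere d
  minWeight≥d (_ , d≤∣S∣) x x≢0 with nonzero⇒∃≉0 x x≢0
  ... | i , xi≉0 with lineSubcode code everywhere xi≉0 ≤-refl
  ... | B , B-indep , small = ≤-trans (d≤∣S∣ B (tabulate (subcodeSupport B)) B-indep (isSupport-tabulate B))
                                      (≤-trans (≤-reflexive (∣tabulate∣≡count (subcodeSupport B)))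
                                               (≤-trans small (≤-reflexive (⌈m/1⌉≡m _))))

  griesmer≤∣S∣ : ∀ {d r} → IsGHW G 1 d → (U : Fin r → Fin k → Carrier) (S : Subset n) →
                 LinIndep U → IsSupport G U S → griesmer q r d ≤ ∣ S ∣
  griesmer≤∣S∣ {d} {r} d₁≡d U S U-indep S-supp = ≤-trans
    (griesmer-bound r (subcode code U U-indep) everywhere d (λ b b≢0 →
      minWeight≥d d₁≡d (lincomb b U) (≉𝟎⇒nonzero (lincomb b U) (λ Ub≈0 → nonzero⇒≉𝟎 b b≢0 (U-indep b Ub≈0)))))
    (≤-reflexive (≡.sym (∣S∣≡count-subcodeSupport U S S-supp)))

  griesmer-isGHW : ∀ {d r} → IsGHW G 1 d → n ≡ griesmer q k d → 1 ≤ r → r ≤ k → IsGHW G r (griesmer q r d)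
  griesmer-isGHW {d} {r} d₁≡d n≡g 1≤r r≤k
    with griesmerCode-subcodes k code everywhere d (minWeight≥d d₁≡d) (≤-reflexive (≡.trans (count-true n) n≡g)) r 1≤r r≤k
  ... | B , B-indep , small =
    (B , tabulate (subcodeSupport B) , B-indep , isSupport-tabulate B ,
      ≤-antisym (≤-trans (≤-reflexive (∣tabulate∣≡count (subcodeSupport B))) small)
                (griesmer≤∣S∣ d₁≡d B _ B-indep (isSupport-tabulate B))) ,
    griesmer≤∣S∣ d₁≡d

open import Level using (Level)
open import Data.Nat using (ℕ; _+_; _*_; _∸_; _^_; _≤_; _<_)
open import Data.Integer as ℤ using (ℤ; +_)
open import Data.Fin using (Fin)
open import Data.Product using (∃; _×_)
open import Relation.Binary.PropositionalEquality using (_≡_)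

open import Data.Nat using (suc; NonZero; >-nonZero)
open import Data.Product using (_,_)
open import Relation.Binary.PropositionalEquality using (trans)
open Arithmetic using (griesmer-split; griesmer≡v*expansion-correction)

mainTheorem2 : ∀ {c ℓ} (F : Field c ℓ) (q : ℕ) → IsPrimePower q → HasOrder F q →
    (k d : ℕ) → 1 ≤ k → 1 ≤ d →
    (σ : ℤ) (ε : ℕ → ℕ) → (∀ i → i < k ∸ 1 → ε i ≤ q ∸ 1) →
    + d ≡ σ ℤ.* + (q ^ (k ∸ 1)) ℤ.- + sumℕ (k ∸ 1) (λ i → ε i * q ^ i) →
    (n : ℕ) → n ≡ griesmer q k d →
    (G : Fin k → Fin n → Field.Carrier F) → LinAlg.LinIndep F G →
    LinAlg.IsGHW F G 1 d →
    ∀ r → 1 ≤ r → r ≤ k →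
      ∃ λ w → LinAlg.IsGHW F G r w
        × + w ≡ + v q r ℤ.* (σ ℤ.* + (q ^ (k ∸ r))
                     ℤ.- + sumRange r (k ∸ 1) (λ i → ε (i ∸ 1) * q ^ (i ∸ r)))
                ℤ.- + sumRange 1 (r ∸ 1) (λ i → ε (i ∸ 1) * v q i)
        × n ≡ w + sumRange 1 (k ∸ r) (λ i → ⌈ w / q ^ i * v q r ⌉)
mainTheorem2 F q _ enum k d 1≤k _ σ ε ε≤q-1 d≡σq^[k-1]-∑εq^i n n≡g G G-indep d₁≡d (suc r) 1≤r r≤k =
  griesmer q (suc r) d ,
  GeneralizedHammingWeights.griesmer-isGHW F enum G G-indep d₁≡d n≡g 1≤r r≤k ,
  griesmer≡v*expansion-correction q {σ = σ} ε≤q-1 d≡σq^[k-1]-∑εq^i r r≤k ,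
  trans n≡g (griesmer-split q d r≤k)
  where
  instance
    q≢0 : NonZero q
    q≢0 = FiniteField.q-nonZero F enum
    k≢0 : NonZero k
    k≢0 = >-nonZero 1≤k
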